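{- Let $q$ be a complex number with $|q|<1$ and let $k\geqslant 1$ be an integer. Then $$\sum_{n=1}^\infty \frac{q^{\binom{k}{2}+(k+1)n}}{(q;q)_n} \begin{bmatrix} n-1\\ k-1 \end{bmatrix} = \frac{q^{k(3k+1)/2}}{(q,q^3;q^3)_\infty} \sum_{n=0}^\infty \frac{q^{n(3n+3k+2)}}{(q^3;q^3)_n(q^2;q^3)_{n+k}} - \frac{q^{k(3k+5)/2+1}}{(q^2,q^3;q^3)_\infty} \sum_{n=0}^\infty \frac{q^{n(3n+3k+4)}}{(q^3;q^3)_n(q;q^3)_{n+k+1}}.$$
   Context: Notation: $(a;q)_0=1$, $(a;q)_n=(1-a)(1-aq)\cdots(1-aq^{n-1})$ for $n>0$, $(a;q)_\infty=\lim_{n\to\infty}(a;q)_n$; $(a_1,\dots,a_r;q)_n=(a_1;q)_n\cdots(a_r;q)_n$ and similarly for $n=\infty$. The Gaussian binomial coefficient is $\begin{bmatrix} n\\ k\end{bmatrix}=\frac{(q;q)_n}{(q;q)_k(q;q)_{n-k}}$ if $0\leqslant k\leqslant n$ and $0$ otherwise. -}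

module Defs where

open import Data.Nat as ℕ using (ℕ; zero; suc; _∸_; _≡ᵇ_; _≤ᵇ_; NonZero)
open import Data.Nat.DivMod using (_%_; _/_)
open import Data.Integer using (ℤ; _+_; _-_; _*_; 0ℤ; 1ℤ)
open import Data.Bool using (if_then_else_)

-- Formal power series in q with integer coefficients:
-- a series is the function  n ↦ (coefficient of q^n).
Series : Set
Series = ℕ → ℤ

sumZ : ℕ → (ℕ → ℤ) → ℤ
sumZ zero    f = 0ℤ
sumZ (suc n) f = sumZ n f + f n

zeroS : Series
zeroS _ = 0ℤ

oneS : Series
oneS zero    = 1ℤ
oneS (suc _) = 0ℤ

qPow : ℕ → Series
qPow m n = if m ≡ᵇ n then 1ℤ else 0ℤ

_⊕_ : Series → Series → Series
(f ⊕ g) n = f n + g n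

_⊖_ : Series → Series → Series
(f ⊖ g) n = f n - g n

_⊛_ : Series → Series → Series
(f ⊛ g) n = sumZ (suc n) (λ i → f i * g (n ∸ i))

infixl 6 _⊕_ _⊖_
infixl 7 _⊛_

sumS : ℕ → (ℕ → Series) → Series
sumS zero    F = zeroS
sumS (suc n) F = sumS n F ⊕ F n

prodS : ℕ → (ℕ → Series) → Series
prodS zero    F = oneS
prodS (suc n) F = prodS n F ⊛ F n

oneMinusQ : ℕ → Series
oneMinusQ a = oneS ⊖ qPow a

-- 1 / (1 - q^a) = Σ_j q^{a j}   (a ≥ 1)
geomS : (a : ℕ) → .{{NonZero a}} → Series
geomS a n = if (n % a) ≡ᵇ 0 then 1ℤ else 0ℤ

-- (q^a ; q^b)_n = Π_{j<n} (1 - q^{a + b j})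
poch : ℕ → ℕ → ℕ → Series
poch a b n = prodS n (λ j → oneMinusQ (a ℕ.+ b ℕ.* j))

invPoch : (a b n : ℕ) → .{{NonZero a}} → Series
invPoch (suc a) b n = prodS n (λ j → geomS (suc a ℕ.+ b ℕ.* j))

gauss : ℕ → ℕ → Series
gauss n k = if k ≤ᵇ n
  then poch 1 1 n ⊛ invPoch 1 1 k ⊛ invPoch 1 1 (n ∸ k)
  else zeroS

-- Left-hand side, partial sum over 1 ≤ n ≤ M:
--   Σ q^{C(k,2) + (k+1) n} / (q;q)_n * [n-1 choose k-1]
lhsPartial : ℕ → ℕ → Series
lhsPartial k M = sumS M (λ m →
  qPow ((k ℕ.* (k ∸ 1)) / 2 ℕ.+ (k ℕ.+ 1) ℕ.* (suc m))
    ⊛ invPoch 1 1 (suc m) ⊛ gauss m (k ∸ 1))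

-- Right-hand side, with both infinite products truncated to M factors
-- and both infinite sums truncated to 0 ≤ n < M.
rhsPartial : ℕ → ℕ → Series
rhsPartial k M =
  qPow ((k ℕ.* (3 ℕ.* k ℕ.+ 1)) / 2) ⊛ invPoch 1 3 M ⊛ invPoch 3 3 M
    ⊛ sumS M (λ n → qPow (n ℕ.* (3 ℕ.* n ℕ.+ 3 ℕ.* k ℕ.+ 2))
                      ⊛ invPoch 3 3 n ⊛ invPoch 2 3 (n ℕ.+ k))
  ⊖ qPow ((k ℕ.* (3 ℕ.* k ℕ.+ 5)) / 2 ℕ.+ 1) ⊛ invPoch 2 3 M ⊛ invPoch 3 3 M
    ⊛ sumS M (λ n → qPow (n ℕ.* (3 ℕ.* n ℕ.+ 3 ℕ.* k ℕ.+ 4))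
                      ⊛ invPoch 3 3 n ⊛ invPoch 1 3 (n ℕ.+ k ℕ.+ 1))

-- Write D k = LHS k - RHS k and compare power series modulo q^T. Both sides satisfy
--   X k + X (k+1) = q^{k(3k+1)/2} (1 - q^{2k+1}) / (q;q)_∞,
-- the left one by Pascal's rule for [n k] and Euler's Σ_n z^n / (q;q)_n = 1 / (z;q)_∞, the right one
-- termwise by Cauchy's identity Σ_n z^n q^{3n²} / ((q³;q³)_n (zq³;q³)_n) = 1 / (zq³;q³)_∞ (a limit of a
-- terminating q-binomial identity) together with (q;q³)_∞ (q²;q³)_∞ (q³;q³)_∞ = (q;q)_∞.
-- Hence D k + D (k+1) = 0 modulo q^T, while D k = O(q^k); alternating from k up to T gives D k = 0 modulo q^T.
module Submission where

open import Defs
open import Algebra.Bundles using (CommutativeRing)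
import Algebra.Construct.Pointwise as Pointwise
import Algebra.Properties.CommutativeSemigroup as CommutativeSemigroupProperties
open import Algebra.Solver.Ring.AlmostCommutativeRing
  using (AlmostCommutativeRing; fromCommutativeRing; _-Raw-AlmostCommutative⟶_)
open import Data.Bool using (if_then_else_; true; false; T)
open import Data.Empty using (⊥-elim)
open import Data.Integer as ℤ using (ℤ; 0ℤ; 1ℤ)
import Data.Integer.Properties as ℤ
open import Data.Maybe using (Maybe; just; nothing)
open import Data.Nat using (ℕ; zero; suc; _+_; _*_; _∸_; _≤_; _<_; _≡ᵇ_; _≤ᵇ_; s≤s; z≤n; _≤?_)
open import Data.Nat.Divisibility using (divides)
open import Data.Nat.DivMod using (_%_; _/_; m<n⇒m%n≡m; [m+n]%n≡m%n; m*n/n≡m; +-distrib-/-∣ʳ; /-monoˡ-≤)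
open import Data.Nat.Properties
  using ( n<1+n; m<n⇒m<1+n; ≤-pred; ≤-refl; ≤-reflexive; ≤-trans; <-≤-trans; ≤-<-trans; <-irrefl; <⇒≤; ≰⇒>; ≮⇒≥
        ; _<?_; <-cmp; ≤⇒≤ᵇ; ≤ᵇ⇒≤; m≤n⇒∃[o]m+o≡n; n≤1+n; m≤m+n; m≤n+m; m≤m*n; m≤n*m; m∸n≤m
        ; +-mono-≤; +-monoˡ-≤; *-monoʳ-≤; +-cancelˡ-<; +-comm; +-assoc; +-suc; +-identityʳ
        ; *-suc; *-zeroʳ; *-identityˡ; *-identityʳ; *-distribˡ-+
        ; m∸[m∸n]≡n; n∸n≡0; +-∸-assoc; m+[n∸m]≡n; m+n∸m≡n; ∸-+-assoc; m∸n+n≡m )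
open import Data.Nat.Tactic.RingSolver using (solve-∀)
open import Data.Product using (∃; _,_)
open import Data.Unit using (tt)
open import Level using (0ℓ)
open import Relation.Binary.Bundles using (Setoid)
open import Relation.Binary.Definitions using (tri<; tri≈; tri>)
open import Relation.Binary.PropositionalEquality
  using (_≡_; refl; sym; trans; cong; cong₂; subst; module ≡-Reasoning)
import Relation.Binary.Reasoning.Setoid as SetoidReasoning
open import Relation.Nullary using (¬_; yes; no)

sumZ-cong : ∀ n {f g : ℕ → ℤ} → (∀ i → i < n → f i ≡ g i) → sumZ n f ≡ sumZ n g
sumZ-cong zero    f≡g = refl
sumZ-cong (suc n) f≡g =
  cong₂ ℤ._+_ (sumZ-cong n (λ i i<n → f≡g i (m<n⇒m<1+n i<n))) (f≡g n (n<1+n n))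

sumZ-zero : ∀ n {f : ℕ → ℤ} → (∀ i → i < n → f i ≡ 0ℤ) → sumZ n f ≡ 0ℤ
sumZ-zero zero    f≡0 = refl
sumZ-zero (suc n) f≡0 =
  cong₂ ℤ._+_ (sumZ-zero n (λ i i<n → f≡0 i (m<n⇒m<1+n i<n))) (f≡0 n (n<1+n n))

sumZ-+ : ∀ n (f g : ℕ → ℤ) → sumZ n (λ i → f i ℤ.+ g i) ≡ sumZ n f ℤ.+ sumZ n g
sumZ-+ zero    f g = refl
sumZ-+ (suc n) f g = trans (cong (ℤ._+ (f n ℤ.+ g n)) (sumZ-+ n f g))
                           (interchange (sumZ n f) (sumZ n g) (f n) (g n))
  where open CommutativeSemigroupProperties ℤ.+-commutativeSemigroup using (interchange)

sumZ-*ˡ : ∀ n c (f : ℕ → ℤ) → c ℤ.* sumZ n f ≡ sumZ n (λ i → c ℤ.* f i)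
sumZ-*ˡ zero    c f = ℤ.*-zeroʳ c
sumZ-*ˡ (suc n) c f = trans (ℤ.*-distribˡ-+ c (sumZ n f) (f n)) (cong (ℤ._+ c ℤ.* f n) (sumZ-*ˡ n c f))

sumZ-*ʳ : ∀ n c (f : ℕ → ℤ) → sumZ n f ℤ.* c ≡ sumZ n (λ i → f i ℤ.* c)
sumZ-*ʳ n c f = trans (ℤ.*-comm (sumZ n f) c)
  (trans (sumZ-*ˡ n c f) (sumZ-cong n (λ i _ → ℤ.*-comm c (f i))))

sumZ-suc : ∀ n (f : ℕ → ℤ) → sumZ (suc n) f ≡ f 0 ℤ.+ sumZ n (λ i → f (suc i))
sumZ-suc zero    f = trans (ℤ.+-identityˡ (f 0)) (sym (ℤ.+-identityʳ (f 0)))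
sumZ-suc (suc n) f = trans (cong (ℤ._+ f (suc n)) (sumZ-suc n f)) (ℤ.+-assoc (f 0) _ _)

sumZ-split : ∀ a b (f : ℕ → ℤ) → sumZ (a + b) f ≡ sumZ a f ℤ.+ sumZ b (λ i → f (a + i))
sumZ-split a zero    f = trans (cong (λ m → sumZ m f) (+-identityʳ a)) (sym (ℤ.+-identityʳ _))
sumZ-split a (suc b) f = begin
  sumZ (a + suc b) f                                       ≡⟨ cong (λ m → sumZ m f) (+-suc a b) ⟩
  sumZ (a + b) f ℤ.+ f (a + b)                             ≡⟨ cong (ℤ._+ f (a + b)) (sumZ-split a b f) ⟩
  (sumZ a f ℤ.+ sumZ b (λ i → f (a + i))) ℤ.+ f (a + b)    ≡⟨ ℤ.+-assoc (sumZ a f) _ _ ⟩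
  sumZ a f ℤ.+ sumZ (suc b) (λ i → f (a + i))              ∎
  where open ≡-Reasoning

sumZ-reverse : ∀ n (f : ℕ → ℤ) → sumZ (suc n) f ≡ sumZ (suc n) (λ i → f (n ∸ i))
sumZ-reverse zero    f = refl
sumZ-reverse (suc n) f = begin
  sumZ (suc n) f ℤ.+ f (suc n)                   ≡⟨ cong (ℤ._+ f (suc n)) (sumZ-reverse n f) ⟩
  sumZ (suc n) (λ i → f (n ∸ i)) ℤ.+ f (suc n)   ≡⟨ ℤ.+-comm _ (f (suc n)) ⟩
  f (suc n) ℤ.+ sumZ (suc n) (λ i → f (n ∸ i))   ≡⟨ sumZ-suc (suc n) (λ i → f (suc n ∸ i)) ⟨
  sumZ (suc (suc n)) (λ i → f (suc n ∸ i))       ∎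
  where open ≡-Reasoning

sumZ-triangle : ∀ n (F : ℕ → ℕ → ℤ) →
  sumZ (suc n) (λ i → sumZ (suc i) (F i)) ≡ sumZ (suc n) (λ j → sumZ (suc (n ∸ j)) (λ b → F (j + b) j))
sumZ-triangle zero    F = refl
sumZ-triangle (suc n) F = begin
  sumZ (suc n) (λ i → sumZ (suc i) (F i)) ℤ.+ (sumZ (suc n) (F (suc n)) ℤ.+ F (suc n) (suc n))
    ≡⟨ cong (ℤ._+ (sumZ (suc n) (F (suc n)) ℤ.+ F (suc n) (suc n))) (sumZ-triangle n F) ⟩
  sumZ (suc n) column ℤ.+ (sumZ (suc n) (F (suc n)) ℤ.+ F (suc n) (suc n))
    ≡⟨ ℤ.+-assoc (sumZ (suc n) column) (sumZ (suc n) (F (suc n))) (F (suc n) (suc n)) ⟨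
  (sumZ (suc n) column ℤ.+ sumZ (suc n) (F (suc n))) ℤ.+ F (suc n) (suc n)
    ≡⟨ cong₂ ℤ._+_ (sumZ-+ (suc n) column (F (suc n))) lastColumn ⟨
  sumZ (suc n) (λ j → column j ℤ.+ F (suc n) j) ℤ.+ sumZ (suc (suc n ∸ suc n)) (λ b → F (suc n + b) (suc n))
    ≡⟨ cong (ℤ._+ sumZ (suc (suc n ∸ suc n)) (λ b → F (suc n + b) (suc n))) (sumZ-cong (suc n) extendColumn) ⟩
  sumZ (suc (suc n)) (λ j → sumZ (suc (suc n ∸ j)) (λ b → F (j + b) j)) ∎
  where
  open ≡-Reasoning
  column : ℕ → ℤ
  column j = sumZ (suc (n ∸ j)) (λ b → F (j + b) j)
  lastColumn : sumZ (suc (suc n ∸ suc n)) (λ b → F (suc n + b) (suc n)) ≡ F (suc n) (suc n)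
  lastColumn rewrite n∸n≡0 n | +-identityʳ n = ℤ.+-identityˡ _
  extendColumn : ∀ j → j < suc n → column j ℤ.+ F (suc n) j ≡ sumZ (suc (suc n ∸ j)) (λ b → F (j + b) j)
  extendColumn j (s≤s j≤n) rewrite +-∸-assoc 1 j≤n =
    cong (λ m → column j ℤ.+ F m j) (trans (cong suc (sym (m+[n∸m]≡n j≤n))) (sym (+-suc j (n ∸ j))))

-- The ring of formal power series

infix 4 _≈_
_≈_ : Series → Series → Set
f ≈ g = ∀ n → f n ≡ g n

negS : Series → Series
negS f n = ℤ.- f n

⊛-cong : ∀ {f f′ g g′} → f ≈ f′ → g ≈ g′ → f ⊛ g ≈ f′ ⊛ g′
⊛-cong f≈f′ g≈g′ n =
  sumZ-cong (suc n) (λ i _ → cong₂ ℤ._*_ (f≈f′ i) (g≈g′ (n ∸ i)))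

⊛-comm : ∀ f g → f ⊛ g ≈ g ⊛ f
⊛-comm f g n = trans (sumZ-reverse n (λ i → f i ℤ.* g (n ∸ i))) (sumZ-cong (suc n) swap)
  where
  swap : ∀ i → i < suc n → f (n ∸ i) ℤ.* g (n ∸ (n ∸ i)) ≡ g i ℤ.* f (n ∸ i)
  swap i i<1+n = trans (cong (λ m → f (n ∸ i) ℤ.* g m) (m∸[m∸n]≡n (≤-pred i<1+n))) (ℤ.*-comm (f (n ∸ i)) (g i))

⊛-assoc : ∀ f g h → (f ⊛ g) ⊛ h ≈ f ⊛ (g ⊛ h)
⊛-assoc f g h n = begin
  sumZ (suc n) (λ i → sumZ (suc i) (λ j → f j ℤ.* g (i ∸ j)) ℤ.* h (n ∸ i))
    ≡⟨ sumZ-cong (suc n) (λ i _ → sumZ-*ʳ (suc i) (h (n ∸ i)) (λ j → f j ℤ.* g (i ∸ j))) ⟩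
  sumZ (suc n) (λ i → sumZ (suc i) (λ j → f j ℤ.* g (i ∸ j) ℤ.* h (n ∸ i)))
    ≡⟨ sumZ-triangle n (λ i j → f j ℤ.* g (i ∸ j) ℤ.* h (n ∸ i)) ⟩
  sumZ (suc n) (λ j → sumZ (suc (n ∸ j)) (λ b → f j ℤ.* g (j + b ∸ j) ℤ.* h (n ∸ (j + b))))
    ≡⟨ sumZ-cong (suc n) (λ j _ → trans (sumZ-cong (suc (n ∸ j)) (λ b _ → reindex j b))
                                        (sym (sumZ-*ˡ (suc (n ∸ j)) (f j) (λ b → g b ℤ.* h (n ∸ j ∸ b))))) ⟩
  sumZ (suc n) (λ j → f j ℤ.* sumZ (suc (n ∸ j)) (λ b → g b ℤ.* h (n ∸ j ∸ b))) ∎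
  where
  open ≡-Reasoning
  reindex : ∀ j b → f j ℤ.* g (j + b ∸ j) ℤ.* h (n ∸ (j + b)) ≡ f j ℤ.* (g b ℤ.* h (n ∸ j ∸ b))
  reindex j b = trans (ℤ.*-assoc (f j) _ _)
    (cong₂ (λ x y → f j ℤ.* (g x ℤ.* h y)) (m+n∸m≡n j b) (sym (∸-+-assoc n j b)))

⊛-distribˡ : ∀ f g h → f ⊛ (g ⊕ h) ≈ f ⊛ g ⊕ f ⊛ h
⊛-distribˡ f g h n =
  trans (sumZ-cong (suc n) (λ i _ → ℤ.*-distribˡ-+ (f i) (g (n ∸ i)) (h (n ∸ i))))
        (sumZ-+ (suc n) (λ i → f i ℤ.* g (n ∸ i)) (λ i → f i ℤ.* h (n ∸ i)))

⊛-distribʳ : ∀ f g h → (g ⊕ h) ⊛ f ≈ g ⊛ f ⊕ h ⊛ f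
⊛-distribʳ f g h n = trans (⊛-comm (g ⊕ h) f n)
  (trans (⊛-distribˡ f g h n) (cong₂ ℤ._+_ (⊛-comm f g n) (⊛-comm f h n)))

⊛-identityˡ : ∀ f → oneS ⊛ f ≈ f
⊛-identityˡ f n = trans (sumZ-suc n (λ i → oneS i ℤ.* f (n ∸ i)))
  (trans (cong₂ ℤ._+_ (ℤ.*-identityˡ (f n)) (sumZ-zero n (λ _ _ → refl))) (ℤ.+-identityʳ (f n)))

⊛-identityʳ : ∀ f → f ⊛ oneS ≈ f
⊛-identityʳ f n = trans (⊛-comm f oneS n) (⊛-identityˡ f n)

seriesRing : CommutativeRing 0ℓ 0ℓ
seriesRing = record
  { Carrier = Series
  ; _≈_ = _≈_
  ; _+_ = _⊕_
  ; _*_ = _⊛_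
  ; -_ = negS
  ; 0# = zeroS
  ; 1# = oneS
  ; isCommutativeRing = record
    { isRing = record
      { +-isAbelianGroup = Pointwise.isAbelianGroup ℕ ℤ.+-0-isAbelianGroup
      ; *-cong = ⊛-cong
      ; *-assoc = ⊛-assoc
      ; *-identity = ⊛-identityˡ , ⊛-identityʳ
      ; distrib = ⊛-distribˡ , ⊛-distribʳ
      }
    ; *-comm = ⊛-comm
    }
  }

open CommutativeRing seriesRing
  using ()
  renaming ( refl to ≈-refl; sym to ≈-sym; trans to ≈-trans; setoid to ≈-setoid
           ; +-cong to ⊕-cong; +-assoc to ⊕-assoc; +-identityˡ to ⊕-identityˡ; +-identityʳ to ⊕-identityʳ
           ; zeroˡ to ⊛-zeroˡ; zeroʳ to ⊛-zeroʳ; -‿inverseʳ to ⊖-self)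

module ≈-Reasoning = SetoidReasoning ≈-setoid

open CommutativeSemigroupProperties (CommutativeRing.+-commutativeSemigroup seriesRing)
  using () renaming (interchange to ⊕-interchange)
open CommutativeSemigroupProperties (CommutativeRing.*-commutativeSemigroup seriesRing)
  using () renaming (interchange to ⊛-interchange)

⊖-cong : ∀ {f f′ g g′} → f ≈ f′ → g ≈ g′ → f ⊖ g ≈ f′ ⊖ g′
⊖-cong f≈f′ g≈g′ n = cong₂ ℤ._-_ (f≈f′ n) (g≈g′ n)

⊛-congˡ : ∀ {f f′} g → f ≈ f′ → f ⊛ g ≈ f′ ⊛ g
⊛-congˡ g f≈f′ = ⊛-cong {g = g} f≈f′ ≈-refl

⊛-congʳ : ∀ {g g′} f → g ≈ g′ → f ⊛ g ≈ f ⊛ g′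
⊛-congʳ f g≈g′ = ⊛-cong {f = f} ≈-refl g≈g′

⊛-zero-middle : ∀ f g → f ⊛ zeroS ⊛ g ≈ zeroS
⊛-zero-middle f g = ≈-trans (⊛-congˡ g (⊛-zeroʳ f)) (⊛-zeroˡ g)

atZero : ℤ → Series
atZero c zero    = c
atZero c (suc _) = 0ℤ

-- The solver's embedding of ℤ. It sends 1ℤ to oneS itself, so that the constant 1 in a solved
-- identity is definitionally oneS.
constant : ℤ → Series
constant (ℤ.pos 1) = oneS
constant c         = atZero c

constant≈atZero : ∀ c → constant c ≈ atZero c
constant≈atZero (ℤ.pos 0)             n       = refl
constant≈atZero (ℤ.pos 1)             zero    = refl
constant≈atZero (ℤ.pos 1)             (suc n) = refl
constant≈atZero (ℤ.pos (suc (suc m))) n       = refl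
constant≈atZero (ℤ.negsuc m)          n       = refl

atZero-+ : ∀ a b → atZero (a ℤ.+ b) ≈ atZero a ⊕ atZero b
atZero-+ a b zero    = refl
atZero-+ a b (suc n) = refl

atZero-* : ∀ a b → atZero (a ℤ.* b) ≈ atZero a ⊛ atZero b
atZero-* a b zero    = sym (ℤ.+-identityˡ (a ℤ.* b))
atZero-* a b (suc n) = sym (sumZ-zero (suc (suc n)) vanish)
  where
  vanish : ∀ i → i < suc (suc n) → atZero a i ℤ.* atZero b (suc n ∸ i) ≡ 0ℤ
  vanish zero    _ = ℤ.*-zeroʳ a
  vanish (suc i) _ = refl

atZero-neg : ∀ a → atZero (ℤ.- a) ≈ negS (atZero a)
atZero-neg a zero    = refl
atZero-neg a (suc n) = refl

seriesACR : AlmostCommutativeRing 0ℓ 0ℓ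
seriesACR = fromCommutativeRing seriesRing

constantMorphism : ℤ.+-*-rawRing -Raw-AlmostCommutative⟶ seriesACR
constantMorphism = record
  { ⟦_⟧    = constant
  ; +-homo = λ a b → ≈-trans (constant≈atZero (a ℤ.+ b))
      (≈-trans (atZero-+ a b) (≈-sym (⊕-cong (constant≈atZero a) (constant≈atZero b))))
  ; *-homo = λ a b → ≈-trans (constant≈atZero (a ℤ.* b))
      (≈-trans (atZero-* a b) (≈-sym (⊛-cong (constant≈atZero a) (constant≈atZero b))))
  ; -‿homo = λ a → ≈-trans (constant≈atZero (ℤ.- a))
      (≈-trans (atZero-neg a) (λ n → sym (cong ℤ.-_ (constant≈atZero a n))))
  ; 0-homo = λ { zero → refl ; (suc n) → refl }
  ; 1-homo = ≈-refl
  }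

constant-≟ : ∀ a b → Maybe (constant a ≈ constant b)
constant-≟ a b with a ℤ.≟ b
... | yes refl = just ≈-refl
... | no _     = nothing

open import Algebra.Solver.Ring ℤ.+-*-rawRing seriesACR constantMorphism constant-≟
  using (solve; _:=_; _:+_; _:-_; _:*_; con)

⊖-interchange : ∀ a b c d → (a ⊖ b) ⊕ (c ⊖ d) ≈ (a ⊕ c) ⊖ (b ⊕ d)
⊖-interchange = solve 4 (λ a b c d → (a :- b) :+ (c :- d) := (a :+ c) :- (b :+ d)) ≈-refl

infix 4 _≈[_]_
_≈[_]_ : Series → ℕ → Series → Set
f ≈[ m ] g = ∀ i → i < m → f i ≡ g i

≈⇒≈[] : ∀ m {f g} → f ≈ g → f ≈[ m ] g
≈⇒≈[] m f≈g i _ = f≈g i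

≡⇒≈ : ∀ {f g} → f ≡ g → f ≈ g
≡⇒≈ refl i = refl

≈[]-setoid : ℕ → Setoid 0ℓ 0ℓ
≈[]-setoid m = record
  { Carrier = Series
  ; _≈_ = _≈[ m ]_
  ; isEquivalence = record
    { refl  = λ i _ → refl
    ; sym   = λ f≈g i i<m → sym (f≈g i i<m)
    ; trans = λ f≈g g≈h i i<m → trans (f≈g i i<m) (g≈h i i<m)
    }
  }

module _ {m : ℕ} where
  open Setoid (≈[]-setoid m) public
    using () renaming (refl to ≈[]-refl; trans to ≈[]-trans)

module ≈[]-Reasoning (m : ℕ) = SetoidReasoning (≈[]-setoid m)

≈[]-weaken : ∀ {f g m m′} → m′ ≤ m → f ≈[ m ] g → f ≈[ m′ ] g
≈[]-weaken m′≤m f≈g i i<m′ = f≈g i (<-≤-trans i<m′ m′≤m)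

⊕-cong[] : ∀ {f f′ g g′ m} → f ≈[ m ] f′ → g ≈[ m ] g′ → f ⊕ g ≈[ m ] f′ ⊕ g′
⊕-cong[] f≈f′ g≈g′ i i<m = cong₂ ℤ._+_ (f≈f′ i i<m) (g≈g′ i i<m)

⊖-cong[] : ∀ {f f′ g g′ m} → f ≈[ m ] f′ → g ≈[ m ] g′ → f ⊖ g ≈[ m ] f′ ⊖ g′
⊖-cong[] f≈f′ g≈g′ i i<m = cong₂ ℤ._-_ (f≈f′ i i<m) (g≈g′ i i<m)

⊛-cong[] : ∀ {f f′ g g′ m} → f ≈[ m ] f′ → g ≈[ m ] g′ → f ⊛ g ≈[ m ] f′ ⊛ g′
⊛-cong[] f≈f′ g≈g′ i i<m = sumZ-cong (suc i) (λ j j<1+i → cong₂ ℤ._*_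
  (f≈f′ j (≤-<-trans (≤-pred j<1+i) i<m)) (g≈g′ (i ∸ j) (≤-<-trans (m∸n≤m i j) i<m)))

⊛-zero[] : ∀ {f m} g → f ≈[ m ] zeroS → f ⊛ g ≈[ m ] zeroS
⊛-zero[] g f≈0 = ≈[]-trans (⊛-cong[] {g = g} f≈0 ≈[]-refl) (≈⇒≈[] _ (⊛-zeroˡ g))

qPow-diag : ∀ e → qPow e e ≡ 1ℤ
qPow-diag zero    = refl
qPow-diag (suc e) = qPow-diag e

qPow-≢ : ∀ e j → ¬ e ≡ j → qPow e j ≡ 0ℤ
qPow-≢ zero    zero    e≢j = ⊥-elim (e≢j refl)
qPow-≢ zero    (suc j) e≢j = refl
qPow-≢ (suc e) zero    e≢j = refl
qPow-≢ (suc e) (suc j) e≢j = qPow-≢ e j (λ e≡j → e≢j (cong suc e≡j))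

qPow-below : ∀ {e j} → j < e → qPow e j ≡ 0ℤ
qPow-below {e} {j} j<e = qPow-≢ e j (λ e≡j → <-irrefl (sym e≡j) j<e)

qPow-above : ∀ {e j} → e < j → qPow e j ≡ 0ℤ
qPow-above {e} {j} e<j = qPow-≢ e j (λ e≡j → <-irrefl e≡j e<j)

qPow-⊛-below : ∀ e f {i} → i < e → (qPow e ⊛ f) i ≡ 0ℤ
qPow-⊛-below e f {i} i<e =
  sumZ-zero (suc i) (λ j j<1+i → cong (ℤ._* f (i ∸ j)) (qPow-below (≤-<-trans (≤-pred j<1+i) i<e)))

qPow-⊛-shift : ∀ e f t → (qPow e ⊛ f) (e + t) ≡ f t
qPow-⊛-shift e f t = begin
  sumZ (suc e + t) term
    ≡⟨ sumZ-split (suc e) t term ⟩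
  (sumZ e term ℤ.+ term e) ℤ.+ sumZ t (λ j → term (suc e + j))
    ≡⟨ cong₂ ℤ._+_ (cong₂ ℤ._+_ (sumZ-zero e (λ j j<e → cong (ℤ._* f (e + t ∸ j)) (qPow-below j<e))) atDiagonal)
                   (sumZ-zero t (λ j _ → cong (ℤ._* f (e + t ∸ (suc e + j))) (qPow-above (s≤s (m≤m+n e j))))) ⟩
  (0ℤ ℤ.+ f t) ℤ.+ 0ℤ
    ≡⟨ trans (ℤ.+-identityʳ _) (ℤ.+-identityˡ _) ⟩
  f t ∎
  where
  open ≡-Reasoning
  term : ℕ → ℤ
  term j = qPow e j ℤ.* f (e + t ∸ j)
  atDiagonal : term e ≡ f t
  atDiagonal = trans (cong₂ ℤ._*_ (qPow-diag e) (cong f (m+n∸m≡n e t))) (ℤ.*-identityˡ (f t))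

≈-split : ∀ a {f g} → (∀ i → i < a → f i ≡ g i) → (∀ t → f (a + t) ≡ g (a + t)) → f ≈ g
≈-split a {f} {g} below above n with n <? a
... | yes n<a = below n n<a
... | no  n≮a = subst (λ m → f m ≡ g m) (m+[n∸m]≡n (≮⇒≥ n≮a)) (above (n ∸ a))

qPow-vanish : ∀ e → qPow e ≈[ e ] zeroS
qPow-vanish e i = qPow-below

qPow-order : ∀ e f → qPow e ⊛ f ≈[ e ] zeroS
qPow-order e f i i<e = qPow-⊛-below e f i<e

qPow-⊛-cong[] : ∀ e {f g m} → f ≈[ m ] g → qPow e ⊛ f ≈[ e + m ] qPow e ⊛ g
qPow-⊛-cong[] e {f} {g} f≈g n n<e+m with n <? e
... | yes n<e = trans (qPow-⊛-below e f n<e) (sym (qPow-⊛-below e g n<e))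
... | no  n≮e = subst (λ m → (qPow e ⊛ f) m ≡ (qPow e ⊛ g) m) (m+[n∸m]≡n e≤n)
  (trans (qPow-⊛-shift e f (n ∸ e))
  (trans (f≈g (n ∸ e) (+-cancelˡ-< e _ _ (subst (_< _) (sym (m+[n∸m]≡n e≤n)) n<e+m)))
         (sym (qPow-⊛-shift e g (n ∸ e)))))
  where e≤n = ≮⇒≥ n≮e

qPow-+ : ∀ a b → qPow a ⊛ qPow b ≈ qPow (a + b)
qPow-+ a b = ≈-split a
  (λ i i<a → trans (qPow-⊛-below a (qPow b) i<a) (sym (qPow-below (<-≤-trans i<a (m≤m+n a b)))))
  (λ t → trans (qPow-⊛-shift a (qPow b) t) (sym (qPow+ a)))
  where
  qPow+ : ∀ a {t} → qPow (a + b) (a + t) ≡ qPow b t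
  qPow+ zero    = refl
  qPow+ (suc a) = qPow+ a

qPow-zero : qPow 0 ≈ oneS
qPow-zero zero    = refl
qPow-zero (suc n) = refl

qPow-cong : ∀ {a b} → a ≡ b → qPow a ≈ qPow b
qPow-cong a≡b = ≡⇒≈ (cong qPow a≡b)

geomS-below : ∀ c {i} → i < suc c → geomS (suc c) i ≡ oneS i
geomS-below c {i} i<1+c rewrite m<n⇒m%n≡m i<1+c with i
... | zero  = refl
... | suc _ = refl

geomS-periodic : ∀ c t → geomS (suc c) (suc c + t) ≡ geomS (suc c) t
geomS-periodic c t = cong (λ r → if r ≡ᵇ 0 then 1ℤ else 0ℤ)
  (trans (cong (_% suc c) (+-comm (suc c) t)) ([m+n]%n≡m%n t (suc c)))

geomS-⊛-oneMinusQ : ∀ c → geomS (suc c) ⊛ oneMinusQ (suc c) ≈ oneS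
geomS-⊛-oneMinusQ c = ≈-trans (expand g Q) (≈-split (suc c)
  (λ i i<1+c → trans (cong₂ ℤ._-_ (geomS-below c i<1+c) (qPow-⊛-below (suc c) g i<1+c)) (ℤ.+-identityʳ (oneS i)))
  (λ t → trans (cong₂ ℤ._-_ (geomS-periodic c t) (qPow-⊛-shift (suc c) g t)) (ℤ.+-inverseʳ (g t))))
  where
  g = geomS (suc c)
  Q = qPow (suc c)
  expand : ∀ g Q → g ⊛ (oneS ⊖ Q) ≈ g ⊖ Q ⊛ g
  expand = solve 2 (λ g Q → g :* (con 1ℤ :- Q) := g :- Q :* g) ≈-refl

geomS-cancel : ∀ c f → geomS (suc c) ⊛ (oneMinusQ (suc c) ⊛ f) ≈ f
geomS-cancel c f = ≈-trans (≈-sym (⊛-assoc (geomS (suc c)) (oneMinusQ (suc c)) f))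
                           (≈-trans (⊛-congˡ f (geomS-⊛-oneMinusQ c)) (⊛-identityˡ f))

geomS-order : ∀ c → geomS (suc c) ≈[ suc c ] oneS
geomS-order c i = geomS-below c

oneMinusQ-order : ∀ c → oneMinusQ (suc c) ≈[ suc c ] oneS
oneMinusQ-order c i i<1+c = trans (cong (λ x → oneS i ℤ.- x) (qPow-below i<1+c)) (ℤ.+-identityʳ (oneS i))

prodS-cong : ∀ n {F G : ℕ → Series} → (∀ j → j < n → F j ≈ G j) → prodS n F ≈ prodS n G
prodS-cong zero    F≈G = ≈-refl
prodS-cong (suc n) F≈G = ⊛-cong (prodS-cong n (λ j j<n → F≈G j (m<n⇒m<1+n j<n))) (F≈G n (n<1+n n))

prodS-cong[] : ∀ n {m} {F G : ℕ → Series} → (∀ j → j < n → F j ≈[ m ] G j) → prodS n F ≈[ m ] prodS n G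
prodS-cong[] zero    F≈G = ≈[]-refl
prodS-cong[] (suc n) F≈G = ⊛-cong[] (prodS-cong[] n (λ j j<n → F≈G j (m<n⇒m<1+n j<n))) (F≈G n (n<1+n n))

prodS-oneS : ∀ n → prodS n (λ _ → oneS) ≈ oneS
prodS-oneS zero    = ≈-refl
prodS-oneS (suc n) = ≈-trans (⊛-identityʳ _) (prodS-oneS n)

prodS-⊛ : ∀ n (F G : ℕ → Series) → prodS n (λ j → F j ⊛ G j) ≈ prodS n F ⊛ prodS n G
prodS-⊛ zero    F G = ≈-sym (⊛-identityʳ oneS)
prodS-⊛ (suc n) F G =
  ≈-trans (⊛-congˡ (F n ⊛ G n) (prodS-⊛ n F G)) (⊛-interchange (prodS n F) (prodS n G) (F n) (G n))

prodS-+ : ∀ a b (F : ℕ → Series) → prodS (a + b) F ≈ prodS a F ⊛ prodS b (λ j → F (a + j))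
prodS-+ a zero    F rewrite +-identityʳ a = ≈-sym (⊛-identityʳ _)
prodS-+ a (suc b) F rewrite +-suc a b =
  ≈-trans (⊛-congˡ (F (a + b)) (prodS-+ a b F)) (⊛-assoc (prodS a F) (prodS b (λ j → F (a + j))) (F (a + b)))

sumS-cong : ∀ n {F G : ℕ → Series} → (∀ j → j < n → F j ≈ G j) → sumS n F ≈ sumS n G
sumS-cong zero    F≈G = ≈-refl
sumS-cong (suc n) F≈G = ⊕-cong (sumS-cong n (λ j j<n → F≈G j (m<n⇒m<1+n j<n))) (F≈G n (n<1+n n))

sumS-cong[] : ∀ n {m} {F G : ℕ → Series} → (∀ j → j < n → F j ≈[ m ] G j) → sumS n F ≈[ m ] sumS n G
sumS-cong[] zero    F≈G = ≈[]-refl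
sumS-cong[] (suc n) F≈G = ⊕-cong[] (sumS-cong[] n (λ j j<n → F≈G j (m<n⇒m<1+n j<n))) (F≈G n (n<1+n n))

sumS-zeroS : ∀ n → sumS n (λ _ → zeroS) ≈ zeroS
sumS-zeroS zero    = ≈-refl
sumS-zeroS (suc n) = ≈-trans (⊕-identityʳ _) (sumS-zeroS n)

sumS-vanish[] : ∀ n {m} {F : ℕ → Series} → (∀ j → j < n → F j ≈[ m ] zeroS) → sumS n F ≈[ m ] zeroS
sumS-vanish[] n F≈0 = ≈[]-trans (sumS-cong[] n F≈0) (≈⇒≈[] _ (sumS-zeroS n))

sumS-⊕ : ∀ n (F G : ℕ → Series) → sumS n (λ j → F j ⊕ G j) ≈ sumS n F ⊕ sumS n G
sumS-⊕ zero    F G = ≈-sym (⊕-identityʳ zeroS)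
sumS-⊕ (suc n) F G = ≈-trans (⊕-cong (sumS-⊕ n F G) ≈-refl) (⊕-interchange (sumS n F) (sumS n G) (F n) (G n))

sumS-⊖ : ∀ n (F G : ℕ → Series) → sumS n (λ j → F j ⊖ G j) ≈ sumS n F ⊖ sumS n G
sumS-⊖ zero    F G = ≈-sym (⊖-self zeroS)
sumS-⊖ (suc n) F G = ≈-trans (⊕-cong (sumS-⊖ n F G) ≈-refl) (⊖-interchange (sumS n F) (sumS n G) (F n) (G n))

⊛-sumS : ∀ n g (F : ℕ → Series) → g ⊛ sumS n F ≈ sumS n (λ j → g ⊛ F j)
⊛-sumS zero    g F = ⊛-zeroʳ g
⊛-sumS (suc n) g F = ≈-trans (⊛-distribˡ g (sumS n F) (F n)) (⊕-cong (⊛-sumS n g F) ≈-refl)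

sumS-⊛ : ∀ n g (F : ℕ → Series) → sumS n F ⊛ g ≈ sumS n (λ j → F j ⊛ g)
sumS-⊛ n g F = ≈-trans (⊛-comm (sumS n F) g) (≈-trans (⊛-sumS n g F) (sumS-cong n (λ j _ → ⊛-comm g (F j))))

sumS-suc : ∀ n (F : ℕ → Series) → sumS (suc n) F ≈ F 0 ⊕ sumS n (λ j → F (suc j))
sumS-suc zero    F = ≈-trans (⊕-identityˡ (F 0)) (≈-sym (⊕-identityʳ (F 0)))
sumS-suc (suc n) F = ≈-trans (⊕-cong (sumS-suc n F) ≈-refl) (⊕-assoc (F 0) (sumS n (λ j → F (suc j))) (F (suc n)))

sumS-+ : ∀ a b (F : ℕ → Series) → sumS (a + b) F ≈ sumS a F ⊕ sumS b (λ j → F (a + j))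
sumS-+ a zero    F rewrite +-identityʳ a = ≈-sym (⊕-identityʳ _)
sumS-+ a (suc b) F rewrite +-suc a b =
  ≈-trans (⊕-cong (sumS-+ a b F) ≈-refl) (⊕-assoc (sumS a F) (sumS b (λ j → F (a + j))) (F (a + b)))

-- q-Pochhammer symbols and Gaussian binomial coefficients

poch-⊛-invPoch : ∀ a b n → poch (suc a) b n ⊛ invPoch (suc a) b n ≈ oneS
poch-⊛-invPoch a b n = begin
  poch (suc a) b n ⊛ invPoch (suc a) b n                               ≈⟨ prodS-⊛ n _ _ ⟨
  prodS n (λ j → oneMinusQ (suc a + b * j) ⊛ geomS (suc a + b * j))    ≈⟨ prodS-cong n (λ j _ → factor j) ⟩
  prodS n (λ _ → oneS)                                                 ≈⟨ prodS-oneS n ⟩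
  oneS                                                                 ∎
  where
  open ≈-Reasoning
  factor : ∀ j → oneMinusQ (suc a + b * j) ⊛ geomS (suc a + b * j) ≈ oneS
  factor j = ≈-trans (⊛-comm (oneMinusQ (suc a + b * j)) (geomS (suc a + b * j))) (geomS-⊛-oneMinusQ (a + b * j))

private
  shiftedIndex : ∀ a b n j → a + b * (n + j) ≡ (a + b * n) + b * j
  shiftedIndex a b n j = trans (cong (a +_) (*-distribˡ-+ b n j)) (sym (+-assoc a (b * n) (b * j)))

invPoch-+ : ∀ a b n m → invPoch (suc a) b (n + m) ≈ invPoch (suc a) b n ⊛ invPoch (suc a + b * n) b m
invPoch-+ a b n m = ≈-trans (prodS-+ n m _)
  (⊛-congʳ (invPoch (suc a) b n) (prodS-cong m (λ j _ → ≡⇒≈ (cong (λ x → geomS (suc x)) (shiftedIndex a b n j)))))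

poch-+ : ∀ a b n m → poch a b (n + m) ≈ poch a b n ⊛ poch (a + b * n) b m
poch-+ a b n m = ≈-trans (prodS-+ n m _)
  (⊛-congʳ (poch a b n) (prodS-cong m (λ j _ → ≡⇒≈ (cong oneMinusQ (shiftedIndex a b n j)))))

invPoch-order : ∀ a b n → invPoch (suc a) b n ≈[ suc a ] oneS
invPoch-order a b n = ≈[]-trans (prodS-cong[] n (λ j _ → ≈[]-weaken (s≤s (m≤m+n a (b * j))) (geomS-order (a + b * j))))
                                (≈⇒≈[] _ (prodS-oneS n))

poch-order : ∀ a b n → poch (suc a) b n ≈[ suc a ] oneS
poch-order a b n = ≈[]-trans (prodS-cong[] n (λ j _ → ≈[]-weaken (s≤s (m≤m+n a (b * j))) (oneMinusQ-order (a + b * j))))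
                             (≈⇒≈[] _ (prodS-oneS n))

invPoch-truncate : ∀ a b n m → invPoch (suc a) b (n + m) ≈[ suc a + b * n ] invPoch (suc a) b n
invPoch-truncate a b n m = ≈[]-trans (≈⇒≈[] _ (invPoch-+ a b n m))
  (≈[]-trans (⊛-cong[] {f = invPoch (suc a) b n} ≈[]-refl (invPoch-order (a + b * n) b m)) (≈⇒≈[] _ (⊛-identityʳ _)))

invPoch-suc : ∀ a b n → invPoch (suc a) b (suc n) ⊛ oneMinusQ (suc a + b * n) ≈ invPoch (suc a) b n
invPoch-suc a b n = ≈-trans (⊛-assoc (invPoch (suc a) b n) (geomS (suc a + b * n)) (oneMinusQ (suc a + b * n)))
  (≈-trans (⊛-congʳ (invPoch (suc a) b n) (geomS-⊛-oneMinusQ (a + b * n))) (⊛-identityʳ _))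

invPoch-cons : ∀ a b n → invPoch (suc a) b (suc n) ≈ geomS (suc a) ⊛ invPoch (suc a + b) b n
invPoch-cons a b n = ≈-trans (invPoch-+ a b 1 n) (⊛-cong first (≡⇒≈ (cong (λ x → invPoch (suc a + x) b n) (*-identityʳ b))))
  where
  first : invPoch (suc a) b 1 ≈ geomS (suc a)
  first = ≈-trans (⊛-identityˡ _) (≡⇒≈ (cong (λ x → geomS (suc x)) (trans (cong (a +_) (*-zeroʳ b)) (+-identityʳ a))))

-- The Gaussian binomial coefficient [L n] in base q^(suc b); gauss is gaussian 0 by definition.
gaussian : ℕ → ℕ → ℕ → Series
gaussian b L n = if n ≤ᵇ L
  then poch (suc b) (suc b) L ⊛ invPoch (suc b) (suc b) n ⊛ invPoch (suc b) (suc b) (L ∸ n)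
  else zeroS

gaussian-≤ : ∀ b {L n} → n ≤ L →
  gaussian b L n ≡ poch (suc b) (suc b) L ⊛ invPoch (suc b) (suc b) n ⊛ invPoch (suc b) (suc b) (L ∸ n)
gaussian-≤ b {L} {n} n≤L with n ≤ᵇ L | ≤⇒≤ᵇ n≤L
... | true | _ = refl

gaussian-> : ∀ b {L n} → L < n → gaussian b L n ≡ zeroS
gaussian-> b {L} {n} L<n with n ≤ᵇ L in eq
... | false = refl
... | true  = ⊥-elim (<-irrefl refl (<-≤-trans L<n (≤ᵇ⇒≤ n L (subst T (sym eq) tt))))

gaussian-zero : ∀ b L → gaussian b L 0 ≈ oneS
gaussian-zero b L = ≈-trans (reorder (poch B B L) (invPoch B B 0) (invPoch B B L))
                   (≈-trans (⊛-identityʳ _) (poch-⊛-invPoch b B L))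
  where
  B = suc b
  reorder : ∀ P I J → P ⊛ I ⊛ J ≈ (P ⊛ J) ⊛ I
  reorder = solve 3 (λ P I J → P :* I :* J := (P :* J) :* I) ≈-refl

gaussian-diag : ∀ b L → gaussian b L L ≈ oneS
gaussian-diag b L rewrite gaussian-≤ b {L} {L} ≤-refl | n∸n≡0 L =
  ≈-trans (⊛-identityʳ _) (poch-⊛-invPoch b (suc b) L)

-- For L = n + r + 1, with A = q^{B(n+1)} and C = q^{B(r+1)}, the new factor 1 - q^{B(L+1)} = 1 - A C of
-- [L+1, n+1] splits as (1 - A) + A (1 - C) or as C (1 - A) + (1 - C).
module _ (b n r : ℕ) where
  private
    B = suc b
    L = suc (n + r)
    P = poch B B L
    I = invPoch B B n
    J = invPoch B B r
    x = geomS (B + B * n)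
    y = geomS (B + B * r)
    A = qPow (B + B * n)
    C = qPow (B + B * r)
    n≤L : n ≤ L
    n≤L = ≤-trans (m≤m+n n r) (n≤1+n _)

    L∸n : L ∸ n ≡ suc r
    L∸n = trans (cong (_∸ n) (sym (+-suc n r))) (m+n∸m≡n n (suc r))

    top : gaussian b (suc L) (suc n) ≈ (P ⊛ (oneS ⊖ A ⊛ C)) ⊛ (I ⊛ x) ⊛ (J ⊛ y)
    top = ≈-trans (≡⇒≈ (gaussian-≤ b (s≤s n≤L)))
      (⊛-cong (⊛-congˡ (I ⊛ x) (⊛-congʳ P (⊖-cong (≈-refl {oneS}) (≈-sym product))))
              (≡⇒≈ (cong (λ m → invPoch B B m) L∸n)))
      where
      exponent : ∀ b n r → (suc b + suc b * n) + (suc b + suc b * r) ≡ suc b + suc b * suc (n + r)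
      exponent = solve-∀
      product : A ⊛ C ≈ qPow (B + B * L)
      product = ≈-trans (qPow-+ (B + B * n) (B + B * r)) (qPow-cong (exponent b n r))

    left : gaussian b L n ≈ P ⊛ I ⊛ (J ⊛ y)
    left = ≈-trans (≡⇒≈ (gaussian-≤ b n≤L)) (⊛-congʳ (P ⊛ I) (≡⇒≈ (cong (λ m → invPoch B B m) L∸n)))

    right : gaussian b L (suc n) ≈ P ⊛ (I ⊛ x) ⊛ J
    right = ≈-trans (≡⇒≈ (gaussian-≤ b (s≤s (m≤m+n n r))))
                    (⊛-congʳ (P ⊛ (I ⊛ x)) (≡⇒≈ (cong (λ m → invPoch B B m) (m+n∸m≡n n r))))

    x-inverse : (oneS ⊖ A) ⊛ x ≈ oneS
    x-inverse = ≈-trans (⊛-comm (oneS ⊖ A) x) (geomS-⊛-oneMinusQ (b + B * n))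

    y-inverse : (oneS ⊖ C) ⊛ y ≈ oneS
    y-inverse = ≈-trans (⊛-comm (oneS ⊖ C) y) (geomS-⊛-oneMinusQ (b + B * r))

    cancel : ∀ {u} w → u ≈ oneS → w ⊛ u ≈ w
    cancel w u≈1 = ≈-trans (⊛-congʳ w u≈1) (⊛-identityʳ w)

  gaussian-pascalˡ-< : gaussian b (suc L) (suc n) ≈ gaussian b L n ⊕ A ⊛ gaussian b L (suc n)
  gaussian-pascalˡ-< = begin
    gaussian b (suc L) (suc n)
      ≈⟨ top ⟩
    (P ⊛ (oneS ⊖ A ⊛ C)) ⊛ (I ⊛ x) ⊛ (J ⊛ y)
      ≈⟨ split P A C I x J y ⟩
    (P ⊛ I ⊛ (J ⊛ y)) ⊛ ((oneS ⊖ A) ⊛ x) ⊕ A ⊛ ((P ⊛ (I ⊛ x) ⊛ J) ⊛ ((oneS ⊖ C) ⊛ y))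
      ≈⟨ ⊕-cong (cancel (P ⊛ I ⊛ (J ⊛ y)) x-inverse) (⊛-congʳ A (cancel (P ⊛ (I ⊛ x) ⊛ J) y-inverse)) ⟩
    P ⊛ I ⊛ (J ⊛ y) ⊕ A ⊛ (P ⊛ (I ⊛ x) ⊛ J)
      ≈⟨ ⊕-cong left (⊛-congʳ A right) ⟨
    gaussian b L n ⊕ A ⊛ gaussian b L (suc n) ∎
    where
    open ≈-Reasoning
    split : ∀ P A C I x J y → (P ⊛ (oneS ⊖ A ⊛ C)) ⊛ (I ⊛ x) ⊛ (J ⊛ y) ≈
            (P ⊛ I ⊛ (J ⊛ y)) ⊛ ((oneS ⊖ A) ⊛ x) ⊕ A ⊛ ((P ⊛ (I ⊛ x) ⊛ J) ⊛ ((oneS ⊖ C) ⊛ y))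
    split = solve 7 (λ P A C I x J y → (P :* (con 1ℤ :- A :* C)) :* (I :* x) :* (J :* y) :=
            (P :* I :* (J :* y)) :* ((con 1ℤ :- A) :* x) :+ A :* ((P :* (I :* x) :* J) :* ((con 1ℤ :- C) :* y))) ≈-refl

  gaussian-pascalʳ-< : gaussian b (suc L) (suc n) ≈ C ⊛ gaussian b L n ⊕ gaussian b L (suc n)
  gaussian-pascalʳ-< = begin
    gaussian b (suc L) (suc n)
      ≈⟨ top ⟩
    (P ⊛ (oneS ⊖ A ⊛ C)) ⊛ (I ⊛ x) ⊛ (J ⊛ y)
      ≈⟨ split P A C I x J y ⟩
    C ⊛ ((P ⊛ I ⊛ (J ⊛ y)) ⊛ ((oneS ⊖ A) ⊛ x)) ⊕ (P ⊛ (I ⊛ x) ⊛ J) ⊛ ((oneS ⊖ C) ⊛ y)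
      ≈⟨ ⊕-cong (⊛-congʳ C (cancel (P ⊛ I ⊛ (J ⊛ y)) x-inverse)) (cancel (P ⊛ (I ⊛ x) ⊛ J) y-inverse) ⟩
    C ⊛ (P ⊛ I ⊛ (J ⊛ y)) ⊕ P ⊛ (I ⊛ x) ⊛ J
      ≈⟨ ⊕-cong (⊛-congʳ C left) right ⟨
    C ⊛ gaussian b L n ⊕ gaussian b L (suc n) ∎
    where
    open ≈-Reasoning
    split : ∀ P A C I x J y → (P ⊛ (oneS ⊖ A ⊛ C)) ⊛ (I ⊛ x) ⊛ (J ⊛ y) ≈
            C ⊛ ((P ⊛ I ⊛ (J ⊛ y)) ⊛ ((oneS ⊖ A) ⊛ x)) ⊕ (P ⊛ (I ⊛ x) ⊛ J) ⊛ ((oneS ⊖ C) ⊛ y)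
    split = solve 7 (λ P A C I x J y → (P :* (con 1ℤ :- A :* C)) :* (I :* x) :* (J :* y) :=
            C :* ((P :* I :* (J :* y)) :* ((con 1ℤ :- A) :* x)) :+ (P :* (I :* x) :* J) :* ((con 1ℤ :- C) :* y)) ≈-refl

gaussian-pascalˡ : ∀ b L n →
  gaussian b (suc L) (suc n) ≈ gaussian b L n ⊕ qPow (suc b + suc b * n) ⊛ gaussian b L (suc n)
gaussian-pascalˡ b L n with <-cmp n L
... | tri< n<L _ _ with m≤n⇒∃[o]m+o≡n n<L
...   | r , refl = gaussian-pascalˡ-< b n r
gaussian-pascalˡ b L n | tri≈ _ refl _ rewrite gaussian-> b {n} {suc n} (n<1+n n) =
  ≈-trans (gaussian-diag b (suc n))
    (≈-sym (≈-trans (⊕-cong (gaussian-diag b n) (⊛-zeroʳ (qPow (suc b + suc b * n)))) (⊕-identityʳ oneS)))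
gaussian-pascalˡ b L n | tri> _ _ L<n
  rewrite gaussian-> b (s≤s L<n) | gaussian-> b L<n | gaussian-> b (m<n⇒m<1+n L<n) =
  ≈-sym (≈-trans (⊕-identityˡ _) (⊛-zeroʳ (qPow (suc b + suc b * n))))

gaussian-pascalʳ : ∀ b L n → n ≤ L →
  gaussian b (suc L) (suc n) ≈ qPow (suc b * (L ∸ n)) ⊛ gaussian b L n ⊕ gaussian b L (suc n)
gaussian-pascalʳ b L n n≤L with <-cmp n L
... | tri< n<L _ _ with m≤n⇒∃[o]m+o≡n n<L
...   | r , refl =
  ≈-trans (gaussian-pascalʳ-< b n r) (⊕-cong (⊛-congˡ (gaussian b (suc (n + r)) n) (qPow-cong exponent)) ≈-refl)
  where
  exponent : suc b + suc b * r ≡ suc b * (suc (n + r) ∸ n)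
  exponent = trans (sym (*-suc (suc b) r))
                   (cong (suc b *_) (sym (trans (cong (_∸ n) (sym (+-suc n r))) (m+n∸m≡n n (suc r)))))
gaussian-pascalʳ b L n n≤L | tri≈ _ refl _ rewrite gaussian-> b {n} {suc n} (n<1+n n) =
  ≈-trans (gaussian-diag b (suc n))
    (≈-sym (≈-trans (⊕-identityʳ _)
                    (≈-trans (⊛-cong (≈-trans (qPow-cong exponent) qPow-zero) (gaussian-diag b n)) (⊛-identityʳ oneS))))
  where
  exponent : suc b * (n ∸ n) ≡ 0
  exponent = trans (cong (suc b *_) (n∸n≡0 n)) (*-zeroʳ (suc b))
gaussian-pascalʳ b L n n≤L | tri> _ _ L<n = ⊥-elim (<-irrefl refl (<-≤-trans L<n n≤L))

-- Euler's identity

eulerSum : ℕ → ℕ → Series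
eulerSum c J = sumS J (λ m → qPow (c * m) ⊛ invPoch 1 1 m)

-- Σ q^{cm}(1 - q^m)/(q;q)_m telescopes to q^c Σ q^{cm}/(q;q)_m after shifting m.
eulerSum-difference : ∀ c J → eulerSum c (suc J) ⊖ eulerSum (suc c) (suc J) ≈ qPow c ⊛ eulerSum c J
eulerSum-difference c J = begin
  eulerSum c (suc J) ⊖ eulerSum (suc c) (suc J)
    ≈⟨ sumS-⊖ (suc J) _ _ ⟨
  sumS (suc J) (λ m → term m ⊖ qPow (suc c * m) ⊛ invPoch 1 1 m)
    ≈⟨ sumS-suc J _ ⟩
  (term 0 ⊖ qPow (c * 0) ⊛ invPoch 1 1 0) ⊕ sumS J (λ m → term (suc m) ⊖ qPow (suc c * suc m) ⊛ invPoch 1 1 (suc m))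
    ≈⟨ ⊕-cong (⊖-self (term 0)) (sumS-cong J (λ m _ → shifted m)) ⟩
  zeroS ⊕ sumS J (λ m → qPow c ⊛ term m)
    ≈⟨ ⊕-identityˡ _ ⟩
  sumS J (λ m → qPow c ⊛ term m)
    ≈⟨ ⊛-sumS J (qPow c) term ⟨
  qPow c ⊛ eulerSum c J ∎
  where
  open ≈-Reasoning
  term : ℕ → Series
  term m = qPow (c * m) ⊛ invPoch 1 1 m
  factor : ∀ Q R I → Q ⊛ I ⊖ (Q ⊛ R) ⊛ I ≈ Q ⊛ (I ⊛ (oneS ⊖ R))
  factor = solve 3 (λ Q R I → Q :* I :- (Q :* R) :* I := Q :* (I :* (con 1ℤ :- R))) ≈-refl
  shifted : ∀ m → term (suc m) ⊖ qPow (suc c * suc m) ⊛ invPoch 1 1 (suc m) ≈ qPow c ⊛ term m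
  shifted m = begin
    term (suc m) ⊖ qPow (suc c * suc m) ⊛ invPoch 1 1 (suc m)
      ≈⟨ ⊖-cong (≈-refl {term (suc m)}) (⊛-congˡ (invPoch 1 1 (suc m))
           (≈-trans (qPow-cong (+-comm (suc m) (c * suc m))) (≈-sym (qPow-+ (c * suc m) (suc m))))) ⟩
    term (suc m) ⊖ (qPow (c * suc m) ⊛ qPow (suc m)) ⊛ invPoch 1 1 (suc m)
      ≈⟨ factor (qPow (c * suc m)) (qPow (suc m)) (invPoch 1 1 (suc m)) ⟩
    qPow (c * suc m) ⊛ (invPoch 1 1 (suc m) ⊛ oneMinusQ (suc m))
      ≈⟨ ⊛-cong (≈-trans (qPow-cong (*-suc c m)) (≈-sym (qPow-+ c (c * m))))
                (≈-trans (⊛-congʳ (invPoch 1 1 (suc m)) (≡⇒≈ (cong (λ e → oneMinusQ (suc e)) (sym (+-identityʳ m)))))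
                         (invPoch-suc 0 1 m)) ⟩
    (qPow c ⊛ qPow (c * m)) ⊛ invPoch 1 1 m
      ≈⟨ ⊛-assoc (qPow c) (qPow (c * m)) (invPoch 1 1 m) ⟩
    qPow c ⊛ term m ∎

eulerSum-functional : ∀ c J → oneMinusQ (suc c) ⊛ eulerSum (suc c) J ≈[ J ] eulerSum (suc (suc c)) J
eulerSum-functional c zero    = λ i ()
eulerSum-functional c (suc J) = begin
  oneMinusQ C ⊛ eulerSum C (suc J)
    ≈⟨ ≈⇒≈[] _ (rearrange (qPow C) W t Y) ⟩
  (Y ⊖ qPow C ⊛ t) ⊕ ((W ⊕ t ⊖ Y) ⊖ qPow C ⊛ W)
    ≈⟨ ≈⇒≈[] _ (⊕-cong (≈-refl {Y ⊖ qPow C ⊛ t}) leftover) ⟩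
  (Y ⊖ qPow C ⊛ t) ⊕ zeroS
    ≈⟨ ≈⇒≈[] _ (⊕-identityʳ _) ⟩
  Y ⊖ qPow C ⊛ t
    ≈⟨ ⊖-cong[] (≈[]-refl {x = Y}) (≈[]-weaken high tailTerm) ⟩
  Y ⊖ zeroS
    ≈⟨ ≈⇒≈[] _ (λ i → ℤ.+-identityʳ (Y i)) ⟩
  Y ∎
  where
  open ≈[]-Reasoning (suc J)
  C = suc c
  W = eulerSum C J
  t = qPow (C * J) ⊛ invPoch 1 1 J
  Y = eulerSum (suc C) (suc J)
  rearrange : ∀ Q W t Y → (oneS ⊖ Q) ⊛ (W ⊕ t) ≈ (Y ⊖ Q ⊛ t) ⊕ ((W ⊕ t ⊖ Y) ⊖ Q ⊛ W)
  rearrange = solve 4 (λ Q W t Y → (con 1ℤ :- Q) :* (W :+ t) := (Y :- Q :* t) :+ ((W :+ t :- Y) :- Q :* W)) ≈-refl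
  leftover : (W ⊕ t ⊖ Y) ⊖ qPow C ⊛ W ≈ zeroS
  leftover = ≈-trans (⊖-cong (eulerSum-difference C J) ≈-refl) (⊖-self (qPow C ⊛ W))
  tailTerm : qPow C ⊛ t ≈[ C + C * J ] zeroS
  tailTerm = ≈[]-trans
    (≈⇒≈[] _ (≈-trans (≈-sym (⊛-assoc (qPow C) (qPow (C * J)) (invPoch 1 1 J))) (⊛-congˡ (invPoch 1 1 J) (qPow-+ C (C * J)))))
    (qPow-order (C + C * J) (invPoch 1 1 J))
  high : suc J ≤ C + C * J
  high = s≤s (≤-trans (m≤m+n J (c * J)) (m≤n+m _ c))

eulerSum-iterate : ∀ j c J → eulerSum (suc c) J ≈[ J ] invPoch (suc c) 1 j ⊛ eulerSum (j + suc c) J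
eulerSum-iterate zero    c J = ≈⇒≈[] J (≈-sym (⊛-identityˡ (eulerSum (suc c) J)))
eulerSum-iterate (suc j) c J = begin
  eulerSum C J
    ≈⟨ ≈⇒≈[] J (geomS-cancel c (eulerSum C J)) ⟨
  geomS C ⊛ (oneMinusQ C ⊛ eulerSum C J)
    ≈⟨ ⊛-cong[] (≈[]-refl {x = geomS C}) (eulerSum-functional c J) ⟩
  geomS C ⊛ eulerSum (suc C) J
    ≈⟨ ⊛-cong[] (≈[]-refl {x = geomS C}) (eulerSum-iterate j (suc c) J) ⟩
  geomS C ⊛ (invPoch (suc C) 1 j ⊛ eulerSum (j + suc C) J)
    ≈⟨ ≈⇒≈[] J (⊛-assoc (geomS C) (invPoch (suc C) 1 j) (eulerSum (j + suc C) J)) ⟨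
  (geomS C ⊛ invPoch (suc C) 1 j) ⊛ eulerSum (j + suc C) J
    ≈⟨ ≈⇒≈[] J (⊛-cong (≈-sym consed) (≡⇒≈ (cong (λ e → eulerSum e J) (+-suc j C)))) ⟩
  invPoch C 1 (suc j) ⊛ eulerSum (suc j + C) J ∎
  where
  open ≈[]-Reasoning J
  C = suc c
  consed : invPoch C 1 (suc j) ≈ geomS C ⊛ invPoch (suc C) 1 j
  consed = ≈-trans (invPoch-cons c 1 j) (⊛-congʳ (geomS C) (≡⇒≈ (cong (λ x → invPoch (suc x) 1 j) (+-comm c 1))))

eulerSum-order : ∀ c J → eulerSum (suc c) (suc J) ≈[ suc c ] oneS
eulerSum-order c J = begin
  eulerSum C (suc J)
    ≈⟨ ≈⇒≈[] C (sumS-suc J term) ⟩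
  term 0 ⊕ sumS J (λ m → term (suc m))
    ≈⟨ ⊕-cong[] (≈⇒≈[] C first) (sumS-vanish[] J (λ m _ → rest m)) ⟩
  oneS ⊕ zeroS
    ≈⟨ ≈⇒≈[] C (⊕-identityʳ oneS) ⟩
  oneS ∎
  where
  open ≈[]-Reasoning (suc c)
  C = suc c
  term : ℕ → Series
  term m = qPow (C * m) ⊛ invPoch 1 1 m
  first : term 0 ≈ oneS
  first = ≈-trans (⊛-identityʳ _) (≈-trans (qPow-cong (*-zeroʳ c)) qPow-zero)
  rest : ∀ m → term (suc m) ≈[ C ] zeroS
  rest m = ≈[]-weaken (m≤m*n C (suc m)) (qPow-order (C * suc m) (invPoch 1 1 (suc m)))

euler : ∀ c J → eulerSum (suc c) J ≈[ J ] invPoch (suc c) 1 J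
euler c zero    = λ i ()
euler c (suc J) = begin
  eulerSum C (suc J)
    ≈⟨ eulerSum-iterate (suc J) c (suc J) ⟩
  invPoch C 1 (suc J) ⊛ eulerSum (suc J + C) (suc J)
    ≈⟨ ⊛-cong[] (≈[]-refl {x = invPoch C 1 (suc J)}) (≈[]-weaken (s≤s (m≤m+n J C)) (eulerSum-order (J + C) J)) ⟩
  invPoch C 1 (suc J) ⊛ oneS
    ≈⟨ ≈⇒≈[] (suc J) (⊛-identityʳ _) ⟩
  invPoch C 1 (suc J) ∎
  where
  open ≈[]-Reasoning (suc J)
  C = suc c

-- Cauchy's identity

cauchyTerm : (b c L n : ℕ) → Series
cauchyTerm b c L n = qPow (n * (suc b * n + c)) ⊛ gaussian b L n ⊛ poch (suc b + c + suc b * n) (suc b) (L ∸ n)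

cauchyTerm-beyond : ∀ b c L → cauchyTerm b c L (suc L) ≈ zeroS
cauchyTerm-beyond b c L rewrite gaussian-> b {L} {suc L} (n<1+n L) =
  ⊛-zero-middle (qPow (suc L * (suc b * suc L + c))) (poch (suc b + c + suc b * suc L) (suc b) (L ∸ suc L))

cauchyTerm-suc-zero : ∀ b c L → cauchyTerm b c (suc L) 0 ≈ cauchyTerm b c L 0 ⊛ oneMinusQ (suc b + c + suc b * L)
cauchyTerm-suc-zero b c L = begin
  qPow 0 ⊛ gaussian b (suc L) 0 ⊛ (P ⊛ oneMinusQ (X + B * L))
    ≈⟨ ⊛-congˡ (P ⊛ oneMinusQ (X + B * L)) (⊛-congʳ (qPow 0) (≈-trans (gaussian-zero b (suc L)) (≈-sym (gaussian-zero b L)))) ⟩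
  qPow 0 ⊛ gaussian b L 0 ⊛ (P ⊛ oneMinusQ (X + B * L))
    ≈⟨ ⊛-assoc (qPow 0 ⊛ gaussian b L 0) P (oneMinusQ (X + B * L)) ⟨
  qPow 0 ⊛ gaussian b L 0 ⊛ P ⊛ oneMinusQ (X + B * L)
    ≈⟨ ⊛-congʳ (qPow 0 ⊛ gaussian b L 0 ⊛ P)
         (≡⇒≈ (cong (λ x → oneMinusQ (x + B * L)) (trans (cong (B + c +_) (*-zeroʳ b)) (+-identityʳ (B + c))))) ⟩
  cauchyTerm b c L 0 ⊛ oneMinusQ (B + c + B * L) ∎
  where
  open ≈-Reasoning
  B = suc b
  X = B + c + B * 0
  P = poch X B L

module _ (b c p : ℕ) where
  private
    B = suc b
    E = qPow (suc p * (B * suc p + c))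
    X = B + c + B * suc p

    peelLastFactor : ∀ d → E ⊛ gaussian b (p + d) (suc p) ⊛ poch X B (p + d ∸ p)
                     ≈ cauchyTerm b c (p + d) (suc p) ⊛ oneMinusQ (B + c + B * (p + d))
    peelLastFactor zero rewrite gaussian-> b {p + 0} {suc p} (s≤s (≤-reflexive (+-identityʳ p))) =
      ≈-trans (⊛-zero-middle E (poch X B (p + 0 ∸ p)))
              (≈-sym (≈-trans (⊛-congˡ (oneMinusQ (B + c + B * (p + 0))) (⊛-zero-middle E (poch X B (p + 0 ∸ suc p))))
                              (⊛-zeroˡ (oneMinusQ (B + c + B * (p + 0))))))
    peelLastFactor (suc m) = begin
      E ⊛ G ⊛ poch X B (p + suc m ∸ p)
        ≈⟨ ⊛-congʳ (E ⊛ G) (≡⇒≈ (cong (poch X B) (m+n∸m≡n p (suc m)))) ⟩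
      E ⊛ G ⊛ (poch X B m ⊛ oneMinusQ (X + B * m))
        ≈⟨ ⊛-assoc (E ⊛ G) (poch X B m) (oneMinusQ (X + B * m)) ⟨
      E ⊛ G ⊛ poch X B m ⊛ oneMinusQ (X + B * m)
        ≈⟨ ⊛-cong (⊛-congʳ (E ⊛ G) (≡⇒≈ (cong (poch X B) (sym top))))
                                                                        (≡⇒≈ (cong oneMinusQ (index b c p m))) ⟩
      cauchyTerm b c (p + suc m) (suc p) ⊛ oneMinusQ (B + c + B * (p + suc m)) ∎
      where
      open ≈-Reasoning
      G = gaussian b (p + suc m) (suc p)
      top : p + suc m ∸ suc p ≡ m
      top = trans (cong (_∸ suc p) (+-suc p m)) (m+n∸m≡n p m)
      index : ∀ b c p m → suc b + c + suc b * suc p + suc b * m ≡ suc b + c + suc b * (p + suc m)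
      index = solve-∀

  -- Pascal's rule [L+1, p+1] = q^{B(L-p)} [L, p] + [L, p+1] splits the term in two.
  cauchyTerm-suc-suc-+ : ∀ d →
    cauchyTerm b c (suc (p + d)) (suc p) ≈ qPow (B + c + B * (p + d)) ⊛ cauchyTerm b (B + c) (p + d) p
                                            ⊕ cauchyTerm b c (p + d) (suc p) ⊛ oneMinusQ (B + c + B * (p + d))
  cauchyTerm-suc-suc-+ d = begin
    E ⊛ gaussian b (suc (p + d)) (suc p) ⊛ P
      ≈⟨ ⊛-congˡ P (⊛-congʳ E (gaussian-pascalʳ b (p + d) p (m≤m+n p d))) ⟩
    E ⊛ (R ⊛ G₀ ⊕ G₁) ⊛ P
      ≈⟨ distribute E R G₀ G₁ P ⟩
    (E ⊛ R) ⊛ G₀ ⊛ P ⊕ E ⊛ G₁ ⊛ P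
      ≈⟨ ⊕-cong (⊛-cong (⊛-congˡ G₀ exponents) (≡⇒≈ (cong (λ x → poch x B (p + d ∸ p)) (shiftedBase b c p)))) (peelLastFactor d) ⟩
    (Q ⊛ qPow (p * (B * p + (B + c)))) ⊛ G₀ ⊛ poch (B + (B + c) + B * p) B (p + d ∸ p)
      ⊕ cauchyTerm b c (p + d) (suc p) ⊛ oneMinusQ (B + c + B * (p + d))
      ≈⟨ ⊕-cong (reassociate Q (qPow (p * (B * p + (B + c)))) G₀ (poch (B + (B + c) + B * p) B (p + d ∸ p))) ≈-refl ⟩
    Q ⊛ cauchyTerm b (B + c) (p + d) p ⊕ cauchyTerm b c (p + d) (suc p) ⊛ oneMinusQ (B + c + B * (p + d)) ∎
    where
    open ≈-Reasoning
    P = poch X B (p + d ∸ p)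
    R = qPow (B * (p + d ∸ p))
    G₀ = gaussian b (p + d) p
    G₁ = gaussian b (p + d) (suc p)
    Q = qPow (B + c + B * (p + d))
    distribute : ∀ E R G₀ G₁ P → E ⊛ (R ⊛ G₀ ⊕ G₁) ⊛ P ≈ (E ⊛ R) ⊛ G₀ ⊛ P ⊕ E ⊛ G₁ ⊛ P
    distribute = solve 5 (λ E R G₀ G₁ P → E :* (R :* G₀ :+ G₁) :* P := (E :* R) :* G₀ :* P :+ E :* G₁ :* P) ≈-refl
    reassociate : ∀ Q F G P → (Q ⊛ F) ⊛ G ⊛ P ≈ Q ⊛ (F ⊛ G ⊛ P)
    reassociate = solve 4 (λ Q F G P → (Q :* F) :* G :* P := Q :* (F :* G :* P)) ≈-refl
    exponent : ∀ b c p d →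
      suc p * (suc b * suc p + c) + suc b * d ≡ (suc b + c + suc b * (p + d)) + p * (suc b * p + (suc b + c))
    exponent = solve-∀
    exponents : E ⊛ R ≈ Q ⊛ qPow (p * (B * p + (B + c)))
    exponents = ≈-trans (qPow-+ (suc p * (B * suc p + c)) (B * (p + d ∸ p)))
      (≈-trans (qPow-cong (trans (cong (λ x → suc p * (B * suc p + c) + B * x) (m+n∸m≡n p d)) (exponent b c p d)))
               (≈-sym (qPow-+ (B + c + B * (p + d)) (p * (B * p + (B + c))))))
    shiftedBase : ∀ b c p → suc b + c + suc b * suc p ≡ suc b + (suc b + c) + suc b * p
    shiftedBase = solve-∀

cauchyTerm-suc-suc : ∀ b c L p → p ≤ L →
  cauchyTerm b c (suc L) (suc p) ≈ qPow (suc b + c + suc b * L) ⊛ cauchyTerm b (suc b + c) L p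
                                   ⊕ cauchyTerm b c L (suc p) ⊛ oneMinusQ (suc b + c + suc b * L)
cauchyTerm-suc-suc b c L p p≤L with m≤n⇒∃[o]m+o≡n p≤L
... | d , refl = cauchyTerm-suc-suc-+ b c p d

cauchySum : (b c L : ℕ) → Series
cauchySum b c L = sumS (suc L) (cauchyTerm b c L)

-- A finite form of Cauchy's identity: with z = q^c and B = b + 1,
--   Σ_{n ≤ L} z^n q^{Bn²} [L n]_{q^B} (z q^{B(n+1)}; q^B)_{L-n} = 1.
cauchySum≈1 : ∀ b c L → cauchySum b c L ≈ oneS
cauchySum≈1 b c zero =
  ≈-trans (⊕-identityˡ _) (≈-trans (⊛-identityʳ _) (≈-trans (⊛-cong qPow-zero (gaussian-zero b 0)) (⊛-identityʳ oneS)))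
cauchySum≈1 b c (suc L) = begin
  sumS (suc (suc L)) (t (suc L))
    ≈⟨ sumS-suc (suc L) (t (suc L)) ⟩
  t (suc L) 0 ⊕ sumS (suc L) (λ p → t (suc L) (suc p))
    ≈⟨ ⊕-cong (cauchyTerm-suc-zero b c L) (sumS-cong (suc L) (λ p p<1+L → cauchyTerm-suc-suc b c L p (≤-pred p<1+L))) ⟩
  t L 0 ⊛ Ω ⊕ sumS (suc L) (λ p → Q ⊛ cauchyTerm b (B + c) L p ⊕ t L (suc p) ⊛ Ω)
    ≈⟨ ⊕-cong (≈-refl {t L 0 ⊛ Ω}) (≈-trans (sumS-⊕ (suc L) _ _)
         (⊕-cong (≈-sym (⊛-sumS (suc L) Q (cauchyTerm b (B + c) L))) (≈-sym (sumS-⊛ (suc L) Ω (λ p → t L (suc p)))))) ⟩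
  t L 0 ⊛ Ω ⊕ (Q ⊛ cauchySum b (B + c) L ⊕ S ⊛ Ω)
    ≈⟨ regroup (t L 0) S (cauchySum b (B + c) L) Q ⟩
  (t L 0 ⊕ S) ⊛ Ω ⊕ Q ⊛ cauchySum b (B + c) L
    ≈⟨ ⊕-cong (⊛-congˡ Ω (≈-sym (sumS-suc (suc L) (t L)))) (⊛-congʳ Q (cauchySum≈1 b (B + c) L)) ⟩
  (cauchySum b c L ⊕ t L (suc L)) ⊛ Ω ⊕ Q ⊛ oneS
    ≈⟨ ⊕-cong (⊛-congˡ Ω (≈-trans (⊕-cong (cauchySum≈1 b c L) (cauchyTerm-beyond b c L)) (⊕-identityʳ oneS))) ≈-refl ⟩
  oneS ⊛ Ω ⊕ Q ⊛ oneS
    ≈⟨ telescope Q ⟩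
  oneS ∎
  where
  open ≈-Reasoning
  B = suc b
  t = cauchyTerm b c
  Q = qPow (B + c + B * L)
  Ω = oneMinusQ (B + c + B * L)
  S = sumS (suc L) (λ p → t L (suc p))
  regroup : ∀ a S W Q → a ⊛ (oneS ⊖ Q) ⊕ (Q ⊛ W ⊕ S ⊛ (oneS ⊖ Q)) ≈ (a ⊕ S) ⊛ (oneS ⊖ Q) ⊕ Q ⊛ W
  regroup = solve 4 (λ a S W Q → a :* (con 1ℤ :- Q) :+ (Q :* W :+ S :* (con 1ℤ :- Q)) :=
                                 (a :+ S) :* (con 1ℤ :- Q) :+ Q :* W) ≈-refl
  telescope : ∀ Q → oneS ⊛ (oneS ⊖ Q) ⊕ Q ⊛ oneS ≈ oneS
  telescope = solve 1 (λ Q → con 1ℤ :* (con 1ℤ :- Q) :+ Q :* con 1ℤ := con 1ℤ) ≈-refl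

gaussian≈invPoch : ∀ b T n → n ≤ T → gaussian b T n ≈[ suc b + suc b * (T ∸ n) ] invPoch (suc b) (suc b) n
gaussian≈invPoch b T n n≤T = begin
  gaussian b T n
    ≈⟨ ≈⇒≈[] _ (≡⇒≈ (gaussian-≤ b n≤T)) ⟩
  poch B B T ⊛ I ⊛ invPoch B B m
    ≈⟨ ≈⇒≈[] _ (⊛-congˡ (invPoch B B m) (⊛-congˡ I (≡⇒≈ (cong (poch B B) (sym (m∸n+n≡m n≤T)))))) ⟩
  poch B B (m + n) ⊛ I ⊛ invPoch B B m
    ≈⟨ ≈⇒≈[] _ (⊛-congˡ (invPoch B B m) (⊛-congˡ I (poch-+ B B m n))) ⟩
  poch B B m ⊛ X ⊛ I ⊛ invPoch B B m
    ≈⟨ ≈⇒≈[] _ (reorder (poch B B m) X I (invPoch B B m)) ⟩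
  (poch B B m ⊛ invPoch B B m) ⊛ (X ⊛ I)
    ≈⟨ ≈⇒≈[] _ (≈-trans (⊛-congˡ (X ⊛ I) (poch-⊛-invPoch b B m)) (⊛-identityˡ (X ⊛ I))) ⟩
  X ⊛ I
    ≈⟨ ⊛-cong[] (poch-order (b + B * m) B n) (≈[]-refl {x = I}) ⟩
  oneS ⊛ I
    ≈⟨ ≈⇒≈[] _ (⊛-identityˡ I) ⟩
  I ∎
  where
  B = suc b
  m = T ∸ n
  I = invPoch B B n
  X = poch (B + B * m) B n
  open ≈[]-Reasoning (B + B * m)
  reorder : ∀ P X I J → P ⊛ X ⊛ I ⊛ J ≈ (P ⊛ J) ⊛ (X ⊛ I)
  reorder = solve 4 (λ P X I J → P :* X :* I :* J := (P :* J) :* (X :* I)) ≈-refl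

cauchyLimitTerm : (b c n : ℕ) → Series
cauchyLimitTerm b c n = qPow (n * (suc b * n + c)) ⊛ invPoch (suc b) (suc b) n ⊛ invPoch (suc b + c) (suc b) n

private
  n≤n*[Bn+c] : ∀ b c n → n ≤ n * (suc b * n + c)
  n≤n*[Bn+c] b c zero    = z≤n
  n≤n*[Bn+c] b c (suc n) = m≤m*n (suc n) (suc b * suc n + c)

module _ (b c T : ℕ) where
  private
    B = suc b
    I′ = invPoch (B + c) B T
    weighted : ℕ → Series
    weighted n = qPow (n * (B * n + c)) ⊛ gaussian b T n ⊛ invPoch (B + c) B n

    cauchyTerm-⊛-invPoch : ∀ n → n ≤ T → cauchyTerm b c T n ⊛ I′ ≈ weighted n
    cauchyTerm-⊛-invPoch n n≤T = begin
      E ⊛ G ⊛ P ⊛ I′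
        ≈⟨ ⊛-congʳ (E ⊛ G ⊛ P) (≡⇒≈ (cong (λ x → invPoch (B + c) B x) (sym (m+[n∸m]≡n n≤T)))) ⟩
      E ⊛ G ⊛ P ⊛ invPoch (B + c) B (n + (T ∸ n))
                                             ≈⟨ ⊛-congʳ (E ⊛ G ⊛ P) (invPoch-+ (b + c) B n (T ∸ n)) ⟩
      E ⊛ G ⊛ P ⊛ (Iₙ ⊛ Iᵣ)
        ≈⟨ reorder E G P Iₙ Iᵣ ⟩
      E ⊛ G ⊛ Iₙ ⊛ (P ⊛ Iᵣ)
        ≈⟨ ⊛-congʳ (E ⊛ G ⊛ Iₙ) (poch-⊛-invPoch (b + c + B * n) B (T ∸ n)) ⟩
      E ⊛ G ⊛ Iₙ ⊛ oneS
        ≈⟨ ⊛-identityʳ (E ⊛ G ⊛ Iₙ) ⟩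
      weighted n ∎
      where
      open ≈-Reasoning
      E = qPow (n * (B * n + c))
      G = gaussian b T n
      P = poch (B + c + B * n) B (T ∸ n)
      Iₙ = invPoch (B + c) B n
      Iᵣ = invPoch (B + c + B * n) B (T ∸ n)
      reorder : ∀ E G P I J → E ⊛ G ⊛ P ⊛ (I ⊛ J) ≈ E ⊛ G ⊛ I ⊛ (P ⊛ J)
      reorder = solve 5 (λ E G P I J → E :* G :* P :* (I :* J) := E :* G :* I :* (P :* J)) ≈-refl

    weighted≈cauchyLimitTerm : ∀ n → n < T → weighted n ≈[ T ] cauchyLimitTerm b c n
    weighted≈cauchyLimitTerm n n<T =
      ≈[]-weaken bound
        (⊛-cong[] (qPow-⊛-cong[] e (gaussian≈invPoch b T n (<⇒≤ n<T))) (≈[]-refl {x = invPoch (B + c) B n}))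
      where
      e = n * (B * n + c)
      bound : T ≤ e + (B + B * (T ∸ n))
      bound = subst (_≤ e + (B + B * (T ∸ n))) (m+[n∸m]≡n (<⇒≤ n<T))
        (+-mono-≤ (n≤n*[Bn+c] b c n) (≤-trans (m≤n*m (T ∸ n) B) (m≤n+m (B * (T ∸ n)) B)))

    weighted-top : weighted T ≈[ T ] zeroS
    weighted-top = ≈[]-weaken (n≤n*[Bn+c] b c T)
      (⊛-zero[] (invPoch (B + c) B T) (qPow-order (T * (B * T + c)) (gaussian b T T)))

  -- Cauchy's identity Σ_n z^n q^{Bn²} / ((q^B; q^B)_n (z q^B; q^B)_n) = 1 / (z q^B; q^B)_∞, obtained from
  -- the finite one because [T n]_{q^B} agrees with 1 / (q^B; q^B)_n up to order B (T - n + 1).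
  cauchyLimit : sumS T (cauchyLimitTerm b c) ≈[ T ] invPoch (suc b + c) (suc b) T
  cauchyLimit = begin
    sumS T (cauchyLimitTerm b c)
      ≈⟨ sumS-cong[] T (λ n n<T → weighted≈cauchyLimitTerm n n<T) ⟨
    sumS T weighted
      ≈⟨ ≈⇒≈[] T (⊕-identityʳ (sumS T weighted)) ⟨
    sumS T weighted ⊕ zeroS
      ≈⟨ ⊕-cong[] (≈[]-refl {x = sumS T weighted}) weighted-top ⟨
    sumS (suc T) weighted
      ≈⟨ ≈⇒≈[] T (sumS-cong (suc T) (λ n n<1+T → cauchyTerm-⊛-invPoch n (≤-pred n<1+T))) ⟨
    sumS (suc T) (λ n → cauchyTerm b c T n ⊛ I′)
                                              ≈⟨ ≈⇒≈[] T (sumS-⊛ (suc T) I′ (cauchyTerm b c T)) ⟨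
    cauchySum b c T ⊛ I′
      ≈⟨ ≈⇒≈[] T (≈-trans (⊛-congˡ I′ (cauchySum≈1 b c T)) (⊛-identityˡ I′)) ⟩
    I′ ∎
    where open ≈[]-Reasoning T

-- The inner sums on the right-hand side have summands innerTerm 2 1 k and (up to rewriting) innerTerm 2 0 (k+1).
innerTerm : (b s j n : ℕ) → Series
innerTerm b s j n =
  qPow (n * (suc b * n + suc b * j + suc s)) ⊛ invPoch (suc b) (suc b) n ⊛ invPoch (suc s) (suc b) (n + j)

module _ (b s j : ℕ) where
  private
    B = suc b
    S = suc s
    c = B * j + S
    base : ∀ b s j → s + suc b * suc j ≡ b + (suc b * j + suc s)
    base = solve-∀
    invPoch-+-shifted : ∀ n → invPoch S B (suc j + n) ≈ invPoch S B (suc j) ⊛ invPoch (B + c) B n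
    invPoch-+-shifted n = ≈-trans (invPoch-+ s B (suc j) n)
      (⊛-congʳ (invPoch S B (suc j)) (≡⇒≈ (cong (λ x → invPoch (suc x) B n) (base b s j))))

  innerTerm-pair : ∀ n →
    innerTerm b s j n ⊕ qPow c ⊛ innerTerm b s (suc j) n ≈ invPoch S B (suc j) ⊛ cauchyLimitTerm b c n
  innerTerm-pair n = begin
    E ⊛ I ⊛ invPoch S B (n + j) ⊕ qPow c ⊛ (E′ ⊛ I ⊛ invPoch S B (n + suc j))
      ≈⟨ ⊕-cong (⊛-congʳ (E ⊛ I) (≈-sym (invPoch-suc s B (n + j))))
                (⊛-congʳ (qPow c) (⊛-congʳ (E′ ⊛ I) (≡⇒≈ (cong (λ x → invPoch S B x) (+-suc n j))))) ⟩
    E ⊛ I ⊛ (K ⊛ (oneS ⊖ Z)) ⊕ qPow c ⊛ (E′ ⊛ I ⊛ K)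
      ≈⟨ ⊕-cong (≈-refl {E ⊛ I ⊛ (K ⊛ (oneS ⊖ Z))}) (≈-trans (reassociate (qPow c) E′ I K) (⊛-congˡ K (⊛-congˡ I shift))) ⟩
    E ⊛ I ⊛ (K ⊛ (oneS ⊖ Z)) ⊕ (E ⊛ Z) ⊛ I ⊛ K
      ≈⟨ telescope E I K Z ⟩
    E ⊛ I ⊛ K
      ≈⟨ ⊛-cong (⊛-congˡ I (qPow-cong (cong (n *_) (+-assoc (B * n) (B * j) S)))) split ⟩
    qPow (n * (B * n + c)) ⊛ I ⊛ (invPoch S B (suc j) ⊛ invPoch (B + c) B n)
      ≈⟨ reorder (qPow (n * (B * n + c))) I (invPoch S B (suc j)) (invPoch (B + c) B n) ⟩
    invPoch S B (suc j) ⊛ cauchyLimitTerm b c n ∎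
    where
    open ≈-Reasoning
    E = qPow (n * (B * n + B * j + S))
    E′ = qPow (n * (B * n + B * suc j + S))
    I = invPoch B B n
    K = invPoch S B (suc (n + j))
    Z = qPow (S + B * (n + j))
    reassociate : ∀ Q F I K → Q ⊛ (F ⊛ I ⊛ K) ≈ (Q ⊛ F) ⊛ I ⊛ K
    reassociate = solve 4 (λ Q F I K → Q :* (F :* I :* K) := (Q :* F) :* I :* K) ≈-refl
    telescope : ∀ E I K Z → E ⊛ I ⊛ (K ⊛ (oneS ⊖ Z)) ⊕ (E ⊛ Z) ⊛ I ⊛ K ≈ E ⊛ I ⊛ K
    telescope = solve 4 (λ E I K Z → E :* I :* (K :* (con 1ℤ :- Z)) :+ (E :* Z) :* I :* K := E :* I :* K) ≈-refl
    reorder : ∀ E I P Q → E ⊛ I ⊛ (P ⊛ Q) ≈ P ⊛ (E ⊛ I ⊛ Q)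
    reorder = solve 4 (λ E I P Q → E :* I :* (P :* Q) := P :* (E :* I :* Q)) ≈-refl
    exponent : ∀ B j S n → (B * j + S) + n * (B * n + B * suc j + S) ≡ n * (B * n + B * j + S) + (S + B * (n + j))
    exponent = solve-∀
    shift : qPow c ⊛ E′ ≈ E ⊛ Z
    shift = ≈-trans (qPow-+ c (n * (B * n + B * suc j + S)))
            (≈-trans (qPow-cong (exponent B j S n)) (≈-sym (qPow-+ (n * (B * n + B * j + S)) (S + B * (n + j)))))
    split : K ≈ invPoch S B (suc j) ⊛ invPoch (B + c) B n
    split = ≈-trans (≡⇒≈ (cong (λ x → invPoch S B (suc x)) (+-comm n j))) (invPoch-+-shifted n)

  innerSum-pair : ∀ T → sumS T (innerTerm b s j) ⊕ qPow c ⊛ sumS T (innerTerm b s (suc j)) ≈[ T ] invPoch S B T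
  innerSum-pair T = begin
    sumS T (innerTerm b s j) ⊕ qPow c ⊛ sumS T (innerTerm b s (suc j))
      ≈⟨ ≈⇒≈[] T (⊕-cong (≈-refl {sumS T (innerTerm b s j)}) (⊛-sumS T (qPow c) (innerTerm b s (suc j)))) ⟩
    sumS T (innerTerm b s j) ⊕ sumS T (λ n → qPow c ⊛ innerTerm b s (suc j) n)
      ≈⟨ ≈⇒≈[] T (sumS-⊕ T (innerTerm b s j) (λ n → qPow c ⊛ innerTerm b s (suc j) n)) ⟨
    sumS T (λ n → innerTerm b s j n ⊕ qPow c ⊛ innerTerm b s (suc j) n)
      ≈⟨ ≈⇒≈[] T (sumS-cong T (λ n _ → innerTerm-pair n)) ⟩
    sumS T (λ n → invPoch S B (suc j) ⊛ cauchyLimitTerm b c n)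
      ≈⟨ ≈⇒≈[] T (⊛-sumS T (invPoch S B (suc j)) (cauchyLimitTerm b c)) ⟨
    invPoch S B (suc j) ⊛ sumS T (cauchyLimitTerm b c)
      ≈⟨ ⊛-cong[] (≈[]-refl {x = invPoch S B (suc j)}) (cauchyLimit b c T) ⟩
    invPoch S B (suc j) ⊛ invPoch (B + c) B T
      ≈⟨ ≈⇒≈[] T (≈-trans (≡⇒≈ (cong (λ x → invPoch S B x) (+-comm T (suc j)))) (invPoch-+-shifted T)) ⟨
    invPoch S B (T + suc j)
      ≈⟨ ≈[]-weaken (≤-trans (m≤n*m T B) (m≤n+m (B * T) S)) (invPoch-truncate s B T (suc j)) ⟩
    invPoch S B T ∎
    where open ≈[]-Reasoning T

  innerSum-pair-scaled : ∀ T e e′ X Y → e′ ≡ e + c →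
    qPow e ⊛ X ⊛ Y ⊛ sumS T (innerTerm b s j) ⊕ qPow e′ ⊛ X ⊛ Y ⊛ sumS T (innerTerm b s (suc j))
      ≈[ T ] qPow e ⊛ (X ⊛ Y ⊛ invPoch S B T)
  innerSum-pair-scaled T e e′ X Y e′≡e+c = begin
    qPow e ⊛ X ⊛ Y ⊛ Σ₀ ⊕ qPow e′ ⊛ X ⊛ Y ⊛ Σ₁
      ≈⟨ ≈⇒≈[] T (⊕-cong (≈-refl {qPow e ⊛ X ⊛ Y ⊛ Σ₀})
                         (⊛-congˡ Σ₁ (⊛-congˡ Y (⊛-congˡ X (≈-trans (qPow-cong e′≡e+c) (≈-sym (qPow-+ e c))))))) ⟩
    qPow e ⊛ X ⊛ Y ⊛ Σ₀ ⊕ (qPow e ⊛ qPow c) ⊛ X ⊛ Y ⊛ Σ₁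
      ≈⟨ ≈⇒≈[] T (factor (qPow e) (qPow c) X Y Σ₀ Σ₁) ⟩
    qPow e ⊛ (X ⊛ Y ⊛ (Σ₀ ⊕ qPow c ⊛ Σ₁))
      ≈⟨ ⊛-cong[] (≈[]-refl {x = qPow e}) (⊛-cong[] (≈[]-refl {x = X ⊛ Y}) (innerSum-pair T)) ⟩
    qPow e ⊛ (X ⊛ Y ⊛ invPoch S B T) ∎
    where
    open ≈[]-Reasoning T
    Σ₀ = sumS T (innerTerm b s j)
    Σ₁ = sumS T (innerTerm b s (suc j))
    factor : ∀ E C X Y Σ₀ Σ₁ → E ⊛ X ⊛ Y ⊛ Σ₀ ⊕ (E ⊛ C) ⊛ X ⊛ Y ⊛ Σ₁ ≈ E ⊛ (X ⊛ Y ⊛ (Σ₀ ⊕ C ⊛ Σ₁))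
    factor = solve 6 (λ E C X Y Σ₀ Σ₁ → E :* X :* Y :* Σ₀ :+ (E :* C) :* X :* Y :* Σ₁ :=
                                        E :* (X :* Y :* (Σ₀ :+ C :* Σ₁))) ≈-refl

-- Modulo q^T: D k = - D (k+1) = D (k+2) = …, and D (k + T) = 0 by the first hypothesis.
vanish-by-alternation : ∀ (D : ℕ → Series) T → (∀ k → D k ≈[ k ] zeroS) →
                        (∀ k → k < T → D k ⊕ D (suc k) ≈[ T ] zeroS) → ∀ k → D k ≈[ T ] zeroS
vanish-by-alternation D T low pair k = go T k (m≤n+m T k)
  where
  go : ∀ d k → T ≤ k + d → D k ≈[ T ] zeroS
  go zero    k T≤k+0 = ≈[]-weaken (≤-trans T≤k+0 (≤-reflexive (+-identityʳ k))) (low k)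
  go (suc d) k T≤k+1+d with T ≤? k
  ... | yes T≤k = ≈[]-weaken T≤k (low k)
  ... | no  T≰k = begin
    D k
      ≈⟨ ≈⇒≈[] T (cancel (D k) (D (suc k))) ⟩
    (D k ⊕ D (suc k)) ⊖ D (suc k)
      ≈⟨ ⊖-cong[] (pair k (≰⇒> T≰k)) (go d (suc k) (≤-trans T≤k+1+d (≤-reflexive (+-suc k d)))) ⟩
    zeroS ⊖ zeroS
      ≈⟨ ≈⇒≈[] T (⊖-self zeroS) ⟩
    zeroS ∎
    where
    open ≈[]-Reasoning T
    cancel : ∀ a b → a ≈ (a ⊕ b) ⊖ b
    cancel = solve 2 (λ a b → a := (a :+ b) :- b) ≈-refl

α β γ : ℕ → ℕ
α k = (k * (3 * k + 1)) / 2
β k = (k * (3 * k + 5)) / 2 + 1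
γ k = (k * (k ∸ 1)) / 2

halve : ∀ a b → (a + b * 2) / 2 ≡ a / 2 + b
halve a b = trans (+-distrib-/-∣ʳ a (divides b refl)) (cong (a / 2 +_) (m*n/n≡m b 2))

α-suc : ∀ k → α (suc k) ≡ α k + (3 * k + 2)
α-suc k = trans (cong (_/ 2) (numerator k)) (halve (k * (3 * k + 1)) (3 * k + 2))
  where
  numerator : ∀ k → suc k * (3 * suc k + 1) ≡ k * (3 * k + 1) + (3 * k + 2) * 2
  numerator = solve-∀

β≡α+ : ∀ k → β k ≡ α k + (2 * k + 1)
β≡α+ k = trans (cong (λ x → x / 2 + 1) (numerator k))
               (trans (cong (_+ 1) (halve (k * (3 * k + 1)) (2 * k))) (+-assoc (α k) (2 * k) 1))
  where
  numerator : ∀ k → k * (3 * k + 5) ≡ k * (3 * k + 1) + (2 * k) * 2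
  numerator = solve-∀

β-suc : ∀ k → β (suc k) ≡ β k + (3 * suc k + 1)
β-suc k = begin
  β (suc k)                                 ≡⟨ β≡α+ (suc k) ⟩
  α (suc k) + (2 * suc k + 1)               ≡⟨ cong (_+ (2 * suc k + 1)) (α-suc k) ⟩
  α k + (3 * k + 2) + (2 * suc k + 1)       ≡⟨ regroup (α k) k ⟩
  α k + (2 * k + 1) + (3 * suc k + 1)       ≡⟨ cong (_+ (3 * suc k + 1)) (β≡α+ k) ⟨
  β k + (3 * suc k + 1)                     ∎
  where
  open ≡-Reasoning
  regroup : ∀ a k → a + (3 * k + 2) + (2 * suc k + 1) ≡ a + (2 * k + 1) + (3 * suc k + 1)
  regroup = solve-∀

γ-suc : ∀ κ → γ (suc (suc κ)) ≡ γ (suc κ) + suc κ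
γ-suc κ = trans (cong (_/ 2) (numerator κ)) (halve (suc κ * κ) (suc κ))
  where
  numerator : ∀ κ → suc (suc κ) * suc κ ≡ suc κ * κ + suc κ * 2
  numerator = solve-∀

α≡γ+ : ∀ κ → α (suc κ) ≡ γ (suc κ) + suc κ * (suc κ + 1)
α≡γ+ κ = trans (cong (_/ 2) (numerator κ)) (halve (suc κ * κ) (suc κ * (suc κ + 1)))
  where
  numerator : ∀ κ → suc κ * (3 * suc κ + 1) ≡ suc κ * κ + suc κ * (suc κ + 1) * 2
  numerator = solve-∀

k≤α : ∀ k → k ≤ α k
k≤α zero    = z≤n
k≤α (suc κ) = subst (_≤ α (suc κ)) (m*n/n≡m (suc κ) 2)
  (/-monoˡ-≤ 2 (*-monoʳ-≤ (suc κ) {2} {3 * suc κ + 1} (s≤s (m≤n+m 1 _))))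

k≤β : ∀ k → k ≤ β k
k≤β k = subst (k ≤_) (sym (β≡α+ k)) (≤-trans (k≤α k) (m≤m+n (α k) _))

threeResidues : ∀ T → invPoch 1 3 T ⊛ invPoch 3 3 T ⊛ invPoch 2 3 T ≈ invPoch 1 1 (3 * T)
threeResidues zero    = ≈-trans (⊛-identityʳ _) (⊛-identityʳ oneS)
threeResidues (suc T) = begin
  (I₁ ⊛ g 0) ⊛ (I₃ ⊛ g 2) ⊛ (I₂ ⊛ g 1)
    ≈⟨ regroup I₁ (g 0) I₃ (g 2) I₂ (g 1) ⟩
  (I₁ ⊛ I₃ ⊛ I₂) ⊛ prodS 3 g
    ≈⟨ ⊛-cong (threeResidues T) (prodS-cong 3 (λ j _ → ≡⇒≈ (cong (λ x → geomS (suc x)) (index T j)))) ⟩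
  invPoch 1 1 (3 * T) ⊛ invPoch (1 + 1 * (3 * T)) 1 3
    ≈⟨ invPoch-+ 0 1 (3 * T) 3 ⟨
  invPoch 1 1 (3 * T + 3)
    ≈⟨ ≡⇒≈ (cong (λ x → invPoch 1 1 x) (three T)) ⟩
  invPoch 1 1 (3 * suc T) ∎
  where
  open ≈-Reasoning
  I₁ = invPoch 1 3 T
  I₂ = invPoch 2 3 T
  I₃ = invPoch 3 3 T
  g : ℕ → Series
  g j = geomS (suc j + 3 * T)
  regroup : ∀ I₁ g₁ I₃ g₃ I₂ g₂ → (I₁ ⊛ g₁) ⊛ (I₃ ⊛ g₃) ⊛ (I₂ ⊛ g₂) ≈ (I₁ ⊛ I₃ ⊛ I₂) ⊛ (((oneS ⊛ g₁) ⊛ g₂) ⊛ g₃)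
  regroup = solve 6 (λ I₁ g₁ I₃ g₃ I₂ g₂ → (I₁ :* g₁) :* (I₃ :* g₃) :* (I₂ :* g₂) :=
                                          (I₁ :* I₃ :* I₂) :* (((con 1ℤ :* g₁) :* g₂) :* g₃)) ≈-refl
  index : ∀ T j → j + 3 * T ≡ 0 + 1 * (3 * T) + 1 * j
  index = solve-∀
  three : ∀ T → 3 * T + 3 ≡ 3 * suc T
  three = solve-∀

threeResidues[] : ∀ T → invPoch 1 3 T ⊛ invPoch 3 3 T ⊛ invPoch 2 3 T ≈[ T ] invPoch 1 1 T
threeResidues[] T = ≈[]-trans (≈⇒≈[] T (≈-trans (threeResidues T) (≡⇒≈ (cong (λ x → invPoch 1 1 x) (split T)))))
                              (≈[]-weaken (n≤1+n T) truncated)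
  where
  truncated : invPoch 1 1 (T + 2 * T) ≈[ suc T ] invPoch 1 1 T
  truncated = subst (λ x → invPoch 1 1 (T + 2 * T) ≈[ suc x ] invPoch 1 1 T) (*-identityˡ T) (invPoch-truncate 0 1 T (2 * T))
  split : ∀ T → 3 * T ≡ T + 2 * T
  split = solve-∀

rhs-secondSum : ∀ k T → sumS T (λ n → qPow (n * (3 * n + 3 * k + 4)) ⊛ invPoch 3 3 n ⊛ invPoch 1 3 (n + k + 1))
                   ≈ sumS T (innerTerm 2 0 (suc k))
rhs-secondSum k T = sumS-cong T (λ n _ → ⊛-cong (⊛-congˡ (invPoch 3 3 n) (qPow-cong (exponent n k)))
                                           (≡⇒≈ (cong (λ x → invPoch 1 3 x) (length n k))))
  where
  exponent : ∀ n k → n * (3 * n + 3 * k + 4) ≡ n * (3 * n + 3 * suc k + 1)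
  exponent = solve-∀
  length : ∀ n k → n + k + 1 ≡ n + suc k
  length = solve-∀

rhsPartial-pair : ∀ k T →
  rhsPartial k T ⊕ rhsPartial (suc k) T ≈[ T ] qPow (α k) ⊛ (oneS ⊖ qPow (2 * k + 1)) ⊛ invPoch 1 1 T
rhsPartial-pair k T = begin
  (A k ⊖ B k) ⊕ (A (suc k) ⊖ B (suc k))
    ≈⟨ ≈⇒≈[] T (⊖-interchange (A k) (B k) (A (suc k)) (B (suc k))) ⟩
  (A k ⊕ A (suc k)) ⊖ (B k ⊕ B (suc k))
    ≈⟨ ⊖-cong[] (innerSum-pair-scaled 2 1 k T (α k) (α (suc k)) I₁ I₃ (α-suc k))
                (≈[]-trans (≈⇒≈[] T (⊕-cong (Bform k) (Bform (suc k))))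
                           (innerSum-pair-scaled 2 0 (suc k) T (β k) (β (suc k)) I₂ I₃ (β-suc k))) ⟩
  qPow (α k) ⊛ (I₁ ⊛ I₃ ⊛ I₂) ⊖ qPow (β k) ⊛ (I₂ ⊛ I₃ ⊛ I₁)
    ≈⟨ ⊖-cong[] (⊛-cong[] (≈[]-refl {x = qPow (α k)}) (threeResidues[] T))
                (⊛-cong[] (≈[]-refl {x = qPow (β k)}) (≈[]-trans (≈⇒≈[] T (swap I₁ I₂ I₃)) (threeResidues[] T))) ⟩
  qPow (α k) ⊛ invPoch 1 1 T ⊖ qPow (β k) ⊛ invPoch 1 1 T
    ≈⟨ ≈⇒≈[] T (⊖-cong (≈-refl {qPow (α k) ⊛ invPoch 1 1 T})
                       (⊛-congˡ (invPoch 1 1 T) (≈-trans (qPow-cong (β≡α+ k)) (≈-sym (qPow-+ (α k) (2 * k + 1)))))) ⟩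
  qPow (α k) ⊛ invPoch 1 1 T ⊖ (qPow (α k) ⊛ qPow (2 * k + 1)) ⊛ invPoch 1 1 T
    ≈⟨ ≈⇒≈[] T (factor (qPow (α k)) (qPow (2 * k + 1)) (invPoch 1 1 T)) ⟩
  qPow (α k) ⊛ (oneS ⊖ qPow (2 * k + 1)) ⊛ invPoch 1 1 T ∎
  where
  open ≈[]-Reasoning T
  I₁ = invPoch 1 3 T
  I₂ = invPoch 2 3 T
  I₃ = invPoch 3 3 T
  A B : ℕ → Series
  A k = qPow (α k) ⊛ I₁ ⊛ I₃ ⊛ sumS T (innerTerm 2 1 k)
  B k = qPow (β k) ⊛ I₂ ⊛ I₃
        ⊛ sumS T (λ n → qPow (n * (3 * n + 3 * k + 4)) ⊛ invPoch 3 3 n ⊛ invPoch 1 3 (n + k + 1))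
  Bform : ∀ k → B k ≈ qPow (β k) ⊛ I₂ ⊛ I₃ ⊛ sumS T (innerTerm 2 0 (suc k))
  Bform k = ⊛-congʳ (qPow (β k) ⊛ I₂ ⊛ I₃) (rhs-secondSum k T)
  swap : ∀ I₁ I₂ I₃ → I₂ ⊛ I₃ ⊛ I₁ ≈ I₁ ⊛ I₃ ⊛ I₂
  swap = solve 3 (λ I₁ I₂ I₃ → I₂ :* I₃ :* I₁ := I₁ :* I₃ :* I₂) ≈-refl
  factor : ∀ Q R I → Q ⊛ I ⊖ (Q ⊛ R) ⊛ I ≈ Q ⊛ (oneS ⊖ R) ⊛ I
  factor = solve 3 (λ Q R I → Q :* I :- (Q :* R) :* I := Q :* (con 1ℤ :- R) :* I) ≈-refl

lhsTerm : ℕ → ℕ → Series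
lhsTerm k m = qPow (γ k + (k + 1) * suc m) ⊛ invPoch 1 1 (suc m) ⊛ gauss m (k ∸ 1)

gaussTerm : ℕ → ℕ → Series
gaussTerm k n = qPow (γ k + (k + 1) * n) ⊛ invPoch 1 1 n ⊛ gauss n k

-- Pascal's rule [m+1, k] = [m, k-1] + q^k [m, k] merges two consecutive left-hand summands.
lhsTerm-pair : ∀ κ m → lhsTerm (suc κ) m ⊕ lhsTerm (suc (suc κ)) m
                      ≈ gaussTerm (suc κ) (suc m) ⊖ qPow (2 * suc κ + 1) ⊛ gaussTerm (suc κ) m
lhsTerm-pair κ m = begin
  E ⊛ I₁ ⊛ G₀ ⊕ qPow (γ (suc k) + (suc k + 1) * suc m) ⊛ I₁ ⊛ G₁
    ≈⟨ ⊕-cong (≈-refl {E ⊛ I₁ ⊛ G₀}) (⊛-congˡ G₁ (⊛-congˡ I₁ outer)) ⟩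
  E ⊛ I₁ ⊛ G₀ ⊕ (E ⊛ A ⊛ Qₘ) ⊛ I₁ ⊛ G₁
    ≈⟨ regroup E A Qₘ I₁ G₀ G₁ ⟩
  E ⊛ I₁ ⊛ (G₀ ⊕ A ⊛ G₁) ⊖ (E ⊛ A) ⊛ (I₁ ⊛ (oneS ⊖ Qₘ)) ⊛ G₁
    ≈⟨ ⊖-cong (⊛-congʳ (E ⊛ I₁) (≈-sym (gaussian-pascalˡ 0 m κ))) (⊛-congˡ G₁ (⊛-cong (≈-sym inner) peel)) ⟩
  E ⊛ I₁ ⊛ gauss (suc m) k ⊖ (qPow (2 * k + 1) ⊛ qPow (γ k + (k + 1) * m)) ⊛ I₀ ⊛ G₁
    ≈⟨ ⊖-cong (≈-refl {E ⊛ I₁ ⊛ gauss (suc m) k}) (reassociate (qPow (2 * k + 1)) (qPow (γ k + (k + 1) * m)) I₀ G₁) ⟩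
  gaussTerm k (suc m) ⊖ qPow (2 * k + 1) ⊛ gaussTerm k m ∎
  where
  open ≈-Reasoning
  k = suc κ
  E = qPow (γ k + (k + 1) * suc m)
  A = qPow (1 + 1 * κ)
  Qₘ = qPow (suc m)
  I₁ = invPoch 1 1 (suc m)
  I₀ = invPoch 1 1 m
  G₀ = gauss m κ
  G₁ = gauss m k
  regroup : ∀ E A Q I G₀ G₁ →
    E ⊛ I ⊛ G₀ ⊕ (E ⊛ A ⊛ Q) ⊛ I ⊛ G₁ ≈ E ⊛ I ⊛ (G₀ ⊕ A ⊛ G₁) ⊖ (E ⊛ A) ⊛ (I ⊛ (oneS ⊖ Q)) ⊛ G₁
  regroup = solve 6 (λ E A Q I G₀ G₁ → E :* I :* G₀ :+ (E :* A :* Q) :* I :* G₁ :=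
                                       E :* I :* (G₀ :+ A :* G₁) :- (E :* A) :* (I :* (con 1ℤ :- Q)) :* G₁) ≈-refl
  reassociate : ∀ Q F I G → (Q ⊛ F) ⊛ I ⊛ G ≈ Q ⊛ (F ⊛ I ⊛ G)
  reassociate = solve 4 (λ Q F I G → (Q :* F) :* I :* G := Q :* (F :* I :* G)) ≈-refl
  outerExponent : ∀ g κ m →
    (g + suc κ) + (suc (suc κ) + 1) * suc m ≡ (g + (suc κ + 1) * suc m) + (1 + 1 * κ) + suc m
  outerExponent = solve-∀
  innerExponent : ∀ g κ m → (2 * suc κ + 1) + (g + (suc κ + 1) * m) ≡ (g + (suc κ + 1) * suc m) + (1 + 1 * κ)
  innerExponent = solve-∀
  outer : qPow (γ (suc k) + (suc k + 1) * suc m) ≈ E ⊛ A ⊛ Qₘ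
  outer = ≈-trans (qPow-cong (trans (cong (_+ (suc k + 1) * suc m) (γ-suc κ)) (outerExponent (γ k) κ m)))
          (≈-trans (≈-sym (qPow-+ (γ k + (k + 1) * suc m + (1 + 1 * κ)) (suc m)))
                   (⊛-congˡ Qₘ (≈-sym (qPow-+ (γ k + (k + 1) * suc m) (1 + 1 * κ)))))
  inner : qPow (2 * k + 1) ⊛ qPow (γ k + (k + 1) * m) ≈ E ⊛ A
  inner = ≈-trans (qPow-+ (2 * k + 1) (γ k + (k + 1) * m))
          (≈-trans (qPow-cong (innerExponent (γ k) κ m)) (≈-sym (qPow-+ (γ k + (k + 1) * suc m) (1 + 1 * κ))))
  peel : I₁ ⊛ (oneS ⊖ Qₘ) ≈ I₀
  peel = ≈-trans (⊛-congʳ I₁ (≡⇒≈ (cong (λ x → oneMinusQ (suc x)) (sym (+-identityʳ m))))) (invPoch-suc 0 1 m)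

gaussTerm-shift : ∀ κ m →
  gaussTerm (suc κ) (suc κ + m) ≈ (qPow (α (suc κ)) ⊛ invPoch 1 1 (suc κ)) ⊛ (qPow (suc (suc κ) * m) ⊛ invPoch 1 1 m)
gaussTerm-shift κ m = begin
  gaussTerm k (k + m)
    ≈⟨ ⊛-cong (⊛-congˡ Iₖₘ powers)
              (≡⇒≈ (trans (gaussian-≤ 0 (m≤m+n k m)) (cong (λ x → Pₖₘ ⊛ Iₖ ⊛ invPoch 1 1 x) (m+n∸m≡n k m)))) ⟩
  (Qₐ ⊛ Q) ⊛ Iₖₘ ⊛ (Pₖₘ ⊛ Iₖ ⊛ invPoch 1 1 m)
    ≈⟨ reorder Qₐ Q Iₖₘ Pₖₘ Iₖ (invPoch 1 1 m) ⟩
  (Qₐ ⊛ Iₖ) ⊛ (Q ⊛ invPoch 1 1 m) ⊛ (Pₖₘ ⊛ Iₖₘ)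
    ≈⟨ ⊛-congʳ ((Qₐ ⊛ Iₖ) ⊛ (Q ⊛ invPoch 1 1 m)) (poch-⊛-invPoch 0 1 (k + m)) ⟩
  (Qₐ ⊛ Iₖ) ⊛ (Q ⊛ invPoch 1 1 m) ⊛ oneS
    ≈⟨ ⊛-identityʳ _ ⟩
  (Qₐ ⊛ Iₖ) ⊛ (Q ⊛ invPoch 1 1 m) ∎
  where
  open ≈-Reasoning
  k = suc κ
  Qₐ = qPow (α k)
  Q = qPow (suc k * m)
  Iₖ = invPoch 1 1 k
  Iₖₘ = invPoch 1 1 (k + m)
  Pₖₘ = poch 1 1 (k + m)
  exponent : ∀ g κ m → g + (suc κ + 1) * (suc κ + m) ≡ (g + suc κ * (suc κ + 1)) + suc (suc κ) * m
  exponent = solve-∀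
  powers : qPow (γ k + (k + 1) * (k + m)) ≈ Qₐ ⊛ Q
  powers = ≈-trans (qPow-cong (trans (exponent (γ k) κ m) (cong (_+ suc k * m) (sym (α≡γ+ κ)))))
                   (≈-sym (qPow-+ (α k) (suc k * m)))
  reorder : ∀ Qₐ Q Iₖₘ Pₖₘ Iₖ Iₘ → (Qₐ ⊛ Q) ⊛ Iₖₘ ⊛ (Pₖₘ ⊛ Iₖ ⊛ Iₘ) ≈ (Qₐ ⊛ Iₖ) ⊛ (Q ⊛ Iₘ) ⊛ (Pₖₘ ⊛ Iₖₘ)
  reorder = solve 6 (λ Qₐ Q Iₖₘ Pₖₘ Iₖ Iₘ → (Qₐ :* Q) :* Iₖₘ :* (Pₖₘ :* Iₖ :* Iₘ) :=
                                           (Qₐ :* Iₖ) :* (Q :* Iₘ) :* (Pₖₘ :* Iₖₘ)) ≈-refl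

-- Only n ≥ k contributes, and there Euler's identity sums the shifted terms.
gaussTerm-sum : ∀ κ T → suc κ ≤ T → sumS T (gaussTerm (suc κ)) ≈[ T ] qPow (α (suc κ)) ⊛ invPoch 1 1 T
gaussTerm-sum κ T k≤T with m≤n⇒∃[o]m+o≡n k≤T
... | J , refl = begin
  sumS (k + J) (gaussTerm k)
    ≈⟨ ≈⇒≈[] T (sumS-+ k J (gaussTerm k)) ⟩
  sumS k (gaussTerm k) ⊕ sumS J (λ m → gaussTerm k (k + m))
    ≈⟨ ≈⇒≈[] T (⊕-cong below (sumS-cong J (λ m _ → gaussTerm-shift κ m))) ⟩
  zeroS ⊕ sumS J (λ m → (Qₐ ⊛ Iₖ) ⊛ eulerTerm m)
    ≈⟨ ≈⇒≈[] T (≈-trans (⊕-identityˡ _) (≈-sym (⊛-sumS J (Qₐ ⊛ Iₖ) eulerTerm))) ⟩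
  (Qₐ ⊛ Iₖ) ⊛ eulerSum (suc k) J
    ≈⟨ ≈⇒≈[] T (⊛-assoc Qₐ Iₖ (eulerSum (suc k) J)) ⟩
  Qₐ ⊛ (Iₖ ⊛ eulerSum (suc k) J)
    ≈⟨ ≈[]-weaken (+-monoˡ-≤ J (k≤α k)) (qPow-⊛-cong[] (α k) (⊛-cong[] (≈[]-refl {x = Iₖ}) (euler k J))) ⟩
  Qₐ ⊛ (Iₖ ⊛ invPoch (suc k) 1 J)
    ≈⟨ ≈⇒≈[] T (⊛-congʳ Qₐ joined) ⟩
  Qₐ ⊛ invPoch 1 1 (k + J) ∎
  where
  k = suc κ
  open ≈[]-Reasoning (k + J)
  Qₐ = qPow (α k)
  Iₖ = invPoch 1 1 k
  eulerTerm : ℕ → Series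
  eulerTerm m = qPow (suc k * m) ⊛ invPoch 1 1 m
  vanishing : ∀ n → n < k → gaussTerm k n ≈ zeroS
  vanishing n n<k = ≈-trans (⊛-congʳ (qPow (γ k + (k + 1) * n) ⊛ invPoch 1 1 n) (≡⇒≈ (gaussian-> 0 n<k)))
                            (⊛-zeroʳ (qPow (γ k + (k + 1) * n) ⊛ invPoch 1 1 n))
  below : sumS k (gaussTerm k) ≈ zeroS
  below = ≈-trans (sumS-cong k vanishing) (sumS-zeroS k)
  joined : Iₖ ⊛ invPoch (suc k) 1 J ≈ invPoch 1 1 (k + J)
  joined = ≈-sym (≈-trans (invPoch-+ 0 1 k J) (⊛-congʳ Iₖ (≡⇒≈ (cong (λ x → invPoch (suc x) 1 J) (+-identityʳ k)))))

lhsPartial-pair : ∀ κ T → suc κ ≤ T →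
  lhsPartial (suc κ) T ⊕ lhsPartial (suc (suc κ)) T
    ≈[ T ] qPow (α (suc κ)) ⊛ (oneS ⊖ qPow (2 * suc κ + 1)) ⊛ invPoch 1 1 T
lhsPartial-pair κ T k≤T = begin
  sumS T (lhsTerm k) ⊕ sumS T (lhsTerm (suc k))
    ≈⟨ ≈⇒≈[] T (sumS-⊕ T (lhsTerm k) (lhsTerm (suc k))) ⟨
  sumS T (λ m → lhsTerm k m ⊕ lhsTerm (suc k) m)
    ≈⟨ ≈⇒≈[] T (sumS-cong T (λ m _ → lhsTerm-pair κ m)) ⟩
  sumS T (λ m → u (suc m) ⊖ Q ⊛ u m)
    ≈⟨ ≈⇒≈[] T (sumS-⊖ T (λ m → u (suc m)) (λ m → Q ⊛ u m)) ⟩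
  sumS T (λ m → u (suc m)) ⊖ sumS T (λ m → Q ⊛ u m)
    ≈⟨ ≈⇒≈[] T (⊖-cong shiftedSum (≈-sym (⊛-sumS T Q u))) ⟩
  (U ⊕ u T) ⊖ Q ⊛ U
    ≈⟨ ≈⇒≈[] T (regroup U (u T) Q) ⟩
  (oneS ⊖ Q) ⊛ U ⊕ u T
    ≈⟨ ⊕-cong[] (⊛-cong[] (≈[]-refl {x = oneS ⊖ Q}) (gaussTerm-sum κ T k≤T)) lastTerm ⟩
  (oneS ⊖ Q) ⊛ (qPow (α k) ⊛ invPoch 1 1 T) ⊕ zeroS
    ≈⟨ ≈⇒≈[] T (≈-trans (⊕-identityʳ _) (commute Q (qPow (α k)) (invPoch 1 1 T))) ⟩
  qPow (α k) ⊛ (oneS ⊖ Q) ⊛ invPoch 1 1 T ∎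
  where
  open ≈[]-Reasoning T
  k = suc κ
  u = gaussTerm k
  U = sumS T u
  Q = qPow (2 * k + 1)
  shiftedSum : sumS T (λ m → u (suc m)) ≈ U ⊕ u T
  shiftedSum = ≈-trans (≈-sym (⊕-identityˡ _))
    (≈-trans (⊕-cong (≈-sym (⊛-zeroʳ (qPow (γ k + (k + 1) * 0) ⊛ invPoch 1 1 0)))
                     (≈-refl {sumS T (λ m → u (suc m))}))
             (≈-sym (sumS-suc T u)))
  lastTerm : u T ≈[ T ] zeroS
  lastTerm = ≈[]-weaken (≤-trans (m≤m+n T ((κ + 1) * T)) (m≤n+m _ (γ k)))
                        (⊛-zero[] (gauss T k) (qPow-order (γ k + (k + 1) * T) (invPoch 1 1 T)))
  regroup : ∀ U v Q → (U ⊕ v) ⊖ Q ⊛ U ≈ (oneS ⊖ Q) ⊛ U ⊕ v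
  regroup = solve 3 (λ U v Q → (U :+ v) :- Q :* U := (con 1ℤ :- Q) :* U :+ v) ≈-refl
  commute : ∀ Q A I → (oneS ⊖ Q) ⊛ (A ⊛ I) ≈ A ⊛ (oneS ⊖ Q) ⊛ I
  commute = solve 3 (λ Q A I → (con 1ℤ :- Q) :* (A :* I) := A :* (con 1ℤ :- Q) :* I) ≈-refl

difference : ℕ → ℕ → Series
difference k T = lhsPartial k T ⊖ rhsPartial k T

difference-order : ∀ k T → difference k T ≈[ k ] zeroS
difference-order k T = ≈[]-trans (⊖-cong[] lhsOrder rhsOrder) (≈⇒≈[] k (⊖-self zeroS))
  where
  lhsOrder : lhsPartial k T ≈[ k ] zeroS
  lhsOrder = sumS-vanish[] T (λ m _ → ⊛-zero[] (gauss m (k ∸ 1)) (≈[]-weaken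
    (≤-trans (m≤m+n k 1) (≤-trans (m≤m*n (k + 1) (suc m)) (m≤n+m _ (γ k))))
    (qPow-order (γ k + (k + 1) * suc m) (invPoch 1 1 (suc m)))))
  rhsOrder : rhsPartial k T ≈[ k ] zeroS
  rhsOrder = ≈[]-trans
    (⊖-cong[] (⊛-zero[] (sumS T (innerTerm 2 1 k)) (⊛-zero[] (invPoch 3 3 T) (⊛-zero[] (invPoch 1 3 T)
                (≈[]-weaken (k≤α k) (qPow-vanish (α k))))))
              (⊛-zero[] (sumS T (λ n → qPow (n * (3 * n + 3 * k + 4)) ⊛ invPoch 3 3 n ⊛ invPoch 1 3 (n + k + 1)))
                (⊛-zero[] (invPoch 3 3 T) (⊛-zero[] (invPoch 2 3 T) (≈[]-weaken (k≤β k) (qPow-vanish (β k)))))))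
    (≈⇒≈[] k (⊖-self zeroS))

difference-pair : ∀ T κ → κ < T → difference (suc κ) T ⊕ difference (suc (suc κ)) T ≈[ T ] zeroS
difference-pair T κ κ<T = begin
  (L ⊖ R) ⊕ (L′ ⊖ R′)      ≈⟨ ≈⇒≈[] T (⊖-interchange L R L′ R′) ⟩
  (L ⊕ L′) ⊖ (R ⊕ R′)      ≈⟨ ⊖-cong[] (lhsPartial-pair κ T κ<T) (rhsPartial-pair (suc κ) T) ⟩
  X ⊖ X                    ≈⟨ ≈⇒≈[] T (⊖-self X) ⟩
  zeroS                    ∎
  where
  open ≈[]-Reasoning T
  L = lhsPartial (suc κ) T
  L′ = lhsPartial (suc (suc κ)) T
  R = rhsPartial (suc κ) T
  R′ = rhsPartial (suc (suc κ)) T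
  X = qPow (α (suc κ)) ⊛ (oneS ⊖ qPow (2 * suc κ + 1)) ⊛ invPoch 1 1 T

difference-vanishes : ∀ T κ → difference (suc κ) T ≈[ T ] zeroS
difference-vanishes T = vanish-by-alternation (λ κ → difference (suc κ) T) T
  (λ κ → ≈[]-weaken (n≤1+n κ) (difference-order (suc κ) T)) (difference-pair T)

corollary5p1 : (k : ℕ) → 1 ≤ k → (N : ℕ) →
    ∃ λ M → (M′ : ℕ) → M ≤ M′ → lhsPartial k M′ N ≡ rhsPartial k M′ N
corollary5p1 (suc κ) _ N = suc N , λ T N<T → ℤ.i-j≡0⇒i≡j _ _ (difference-vanishes T κ N N<T)
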